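{- For every strongly connected pure $(d-1)$-dimensional simplicial complex with $n$ vertices and diameter $\delta$, there is a $(d-1)$-dimensional pseudo-manifold without boundary with $2n$ vertices and diameter at least $\delta+2$.
   Context: A pure simplicial complex of dimension $d-1$ on a vertex set $V$ is a family $C$ of $d$-element subsets of $V$, called facets; it has $n$ vertices when $|V|=n$. A ridge of $C$ is a $(d-1)$-element subset of some facet. The dual graph $G(C)$ has the facets as vertices, two facets being adjacent iff they share a ridge (i.e. differ in exactly one element). $C$ is strongly connected if $G(C)$ is connected; its diameter is the graph diameter of $G(C)$. A pseudo-manifold without boundary is a strongly connected pure complex in which every ridge is contained in exactly two facets. -}

module Defs where

open import Data.Nat using (ℕ; zero; suc; _+_; _≤_)
open import Data.Bool using (Bool; true; false)
open import Data.Fin.Subset using (Subset; _⊆_; ∣_∣)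
open import Data.Product using (Σ; ∃; _×_; _,_)
open import Data.Sum using (_⊎_)
open import Relation.Binary.PropositionalEquality using (_≡_; _≢_)

-- A family of subsets of the vertex set V = Fin n, given by its
-- (decidable) characteristic function.  F is a facet iff C F ≡ true.
Complex : ℕ → Set
Complex n = Subset n → Bool

_∈C_ : ∀ {n} → Subset n → Complex n → Set
F ∈C C = C F ≡ true

IsPure : ∀ {n} → ℕ → Complex n → Set
IsPure d C = ∀ F → F ∈C C → ∣ F ∣ ≡ d

IsRidge : ∀ {n} → ℕ → Complex n → Subset n → Set
IsRidge {n} d C R = suc ∣ R ∣ ≡ d × Σ (Subset n) λ F → F ∈C C × R ⊆ F

Adjacent : ∀ {n} → ℕ → Complex n → Subset n → Subset n → Set
Adjacent {n} d C F G =
  F ∈C C × G ∈C C × F ≢ G ×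
  Σ (Subset n) λ R → suc ∣ R ∣ ≡ d × R ⊆ F × R ⊆ G

data Walk {n} (d : ℕ) (C : Complex n) : Subset n → Subset n → ℕ → Set where
  here : ∀ {F} → F ∈C C → Walk d C F F zero
  step : ∀ {F G H k} → Adjacent d C F G → Walk d C G H k → Walk d C F H (suc k)

StronglyConnected : ∀ {n} → ℕ → Complex n → Set
StronglyConnected d C =
  ∀ F G → F ∈C C → G ∈C C → ∃ λ k → Walk d C F G k

DistEq : ∀ {n} → ℕ → Complex n → Subset n → Subset n → ℕ → Set
DistEq d C F G k = Walk d C F G k × (∀ m → Walk d C F G m → k ≤ m)

HasDiameter : ∀ {n} → ℕ → Complex n → ℕ → Set
HasDiameter {n} d C δ =
  (∀ F G → F ∈C C → G ∈C C → ∃ λ k → k ≤ δ × Walk d C F G k) ×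
  Σ (Subset n) λ F → Σ (Subset n) λ G → F ∈C C × G ∈C C × DistEq d C F G δ

DiameterAtLeast : ∀ {n} → ℕ → Complex n → ℕ → Set
DiameterAtLeast {n} d C δ =
  Σ (Subset n) λ F → Σ (Subset n) λ G → F ∈C C × G ∈C C ×
    (∀ m → Walk d C F G m → δ ≤ m)

IsPseudoManifold : ∀ {n} → ℕ → Complex n → Set
IsPseudoManifold {n} d C =
  IsPure d C × StronglyConnected d C ×
  (∀ R → IsRidge d C R →
    Σ (Subset n) λ F → Σ (Subset n) λ G →
      F ∈C C × G ∈C C × F ≢ G × R ⊆ F × R ⊆ G ×
      (∀ H → H ∈C C → R ⊆ H → H ≡ F ⊎ H ≡ G))

module Submission where

open import Data.Bool using (Bool; true; false; not; _∧_; _∨_; if_then_else_)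
open import Data.Bool.Properties
  using (∧-identityʳ; ∧-zeroʳ; ∨-identityʳ; ∨-zeroʳ; not-involutive; ¬-not) renaming (_≟_ to _≟B_)
open import Data.Empty using (⊥; ⊥-elim)
open import Data.Fin using (Fin; zero; suc; toℕ; _↑ˡ_; _↑ʳ_; splitAt) renaming (_≟_ to _≟F_)
import Data.Fin.Properties as Fin
open import Data.Fin.Properties using (splitAt⁻¹-↑ˡ; splitAt⁻¹-↑ʳ; toℕ-↑ˡ; toℕ-↑ʳ; toℕ<n; ¬∀⟶∃¬)
open import Data.Fin.Subset using (Subset; _⊆_; ∣_∣; ⁅_⁆)
open import Data.Fin.Subset.Properties using (x∈⁅y⁆⇒x≡y; ∣⁅x⁆∣≡1)
open import Data.Nat using (ℕ; zero; suc; _+_; _*_; _∸_; _≤_; _<_; z≤n; s≤s; _≤?_)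
open import Data.Nat.Properties
open import Data.Product using (Σ; _×_; _,_; proj₁; proj₂)
open import Data.Sum using (_⊎_; inj₁; inj₂)
open import Data.Unit using (⊤; tt)
open import Data.Vec using ([]; _∷_; lookup; tabulate; _++_)
open import Data.Vec.Properties
  using (lookup∘tabulate; tabulate∘lookup; tabulate-cong; []=⇒lookup; lookup⇒[]=; lookup-++ˡ; lookup-++ʳ)
  renaming (≡-dec to ≡-decV)
open import Relation.Binary.Definitions using (tri<; tri≈; tri>)
open import Relation.Binary.PropositionalEquality
open import Relation.Nullary using (¬_; Dec; yes; no)
open import Relation.Nullary.Decidable using (⌊_⌋)
open import Defs

-- Fix a shortest path F 0, …, F δ in the dual graph of C; at step i the vertex ℓ i leaves and
-- e (i + 1) enters.  The pseudo-manifold P lives on two copies of the vertex set.  Its "tube" over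
-- F j is the boundary of the cross-polytope on F j (each vertex taken in one of its two copies),
-- restricted to the facets carrying ℓ j and e j in the same copy.  Dropping ℓ j from such a facet
-- leads into the tube over F (j + 1), dropping e j into the tube over F (j - 1), and dropping any
-- other vertex leads to the facet with that vertex in the other copy.  The ends are closed by two
-- caps: the left one contains both copies of a vertex wL of F 0 and splits F 0 - e 0 - wL, and
-- the right one is symmetric.  So every ridge lies in exactly two facets and every facet is
-- connected to the left cap.  Finally, give the left cap level 0, the tube over F j level j + 1
-- and the right cap level δ + 2: since on a shortest path non-consecutive facets share no ridge,
-- adjacent facets of P have levels differing by at most one, so the caps are δ + 2 apart.

∧-true : ∀ {a b} → (a ∧ b) ≡ true → a ≡ true × b ≡ true
∧-true {true} {true} h = refl , refl

∧not-true : ∀ {a b} → (a ∧ not b) ≡ true → a ≡ true × b ≡ false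
∧not-true {true} {false} h = refl , refl

∨-true : ∀ {a b} → (a ∨ b) ≡ true → a ≡ true ⊎ b ≡ true
∨-true {true} h = inj₁ refl
∨-true {false} h = inj₂ h

∨-trueʳ : ∀ a b → b ≡ true → (a ∨ b) ≡ true
∨-trueʳ true b h = refl
∨-trueʳ false b h = h

split-∨ : ∀ f x → ((f ∧ not x) ∨ (f ∧ x)) ≡ f
split-∨ true true = refl
split-∨ true false = refl
split-∨ false x = refl

split-∧ : ∀ f x → ((f ∧ not x) ∧ (f ∧ x)) ≡ false
split-∧ true true = refl
split-∧ true false = refl
split-∧ false x = refl

∧-not-absorb : ∀ f x → (f ∧ not (f ∧ x)) ≡ (f ∧ not x)
∧-not-absorb true x = refl
∧-not-absorb false x = refl

∧-absorb : ∀ f x → (f ∧ (f ∧ x)) ≡ (f ∧ x)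
∧-absorb true x = refl
∧-absorb false x = refl

∨-∧-not-absorb : ∀ z x w → ((z ∧ not ((z ∧ x) ∨ w)) ∨ w) ≡ ((z ∧ not x) ∨ w)
∨-∧-not-absorb true true true = refl
∨-∧-not-absorb true true false = refl
∨-∧-not-absorb true false true = refl
∨-∧-not-absorb true false false = refl
∨-∧-not-absorb false x true = refl
∨-∧-not-absorb false x false = refl

∨-∧-absorb : ∀ z x w → ((z ∧ ((z ∧ x) ∨ w)) ∨ w) ≡ ((z ∧ x) ∨ w)
∨-∧-absorb true true true = refl
∨-∧-absorb true true false = refl
∨-∧-absorb true false true = refl
∨-∧-absorb true false false = refl
∨-∧-absorb false x true = refl
∨-∧-absorb false x false = refl

true≢false : ¬ true ≡ false
true≢false ()

bit-clash : ∀ {a} → a ≡ true → a ≡ false → ⊥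
bit-clash refl ()

not-≢ : ∀ c → ¬ not c ≡ c
not-≢ true ()
not-≢ false ()

consecutive : ∀ i j → j ≤ suc i → i ≤ suc j → ¬ i ≡ j → j ≡ suc i ⊎ i ≡ suc j
consecutive i j h1 h2 ne with <-cmp i j
... | tri< lt _ _ = inj₁ (≤-antisym h1 lt)
... | tri≈ _ e _ = ⊥-elim (ne e)
... | tri> _ _ gt = inj₂ (≤-antisym h2 gt)

≤1∧≢1⇒≡0 : ∀ i → i ≤ 1 → ¬ i ≡ 1 → i ≡ 0
≤1∧≢1⇒≡0 zero _ _ = refl
≤1∧≢1⇒≡0 (suc zero) _ q = ⊥-elim (q refl)
≤1∧≢1⇒≡0 (suc (suc _)) (s≤s ()) _

≤-suc-≢⇒≡ : ∀ i D → i ≤ D → D ≤ suc i → ¬ suc i ≡ D → i ≡ D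
≤-suc-≢⇒≡ i D h1 h2 q with m≤n⇒m<n∨m≡n h1
... | inj₂ e = e
... | inj₁ lt = ⊥-elim (q (≤-antisym lt h2))

any≤ : ℕ → (ℕ → Bool) → Bool
any≤ zero f = f zero
any≤ (suc k) f = f (suc k) ∨ any≤ k f

any≤-sound : ∀ k f → any≤ k f ≡ true → Σ ℕ λ j → j ≤ k × f j ≡ true
any≤-sound zero f h = zero , z≤n , h
any≤-sound (suc k) f h with f (suc k) in eq
... | true = suc k , ≤-refl , eq
... | false with any≤-sound k f h
... | j , le , fj = j , m≤n⇒m≤1+n le , fj

any≤-complete : ∀ k f j → j ≤ k → f j ≡ true → any≤ k f ≡ true
any≤-complete zero f .zero z≤n h = h
any≤-complete (suc k) f j le h with f (suc k) in eq
... | true = refl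
... | false with m≤n⇒m<n∨m≡n le
...   | inj₁ (s≤s lt) = any≤-complete k f j lt h
...   | inj₂ refl = ⊥-elim (bit-clash h eq)

_⊑_ : ∀ {m} → Subset m → Subset m → Set
p ⊑ q = ∀ x → lookup p x ≡ true → lookup q x ≡ true

⊆⇒⊑ : ∀ {m} {p q : Subset m} → p ⊆ q → p ⊑ q
⊆⇒⊑ {p = p} {q} h x e = []=⇒lookup (h (lookup⇒[]= x p e))

⊑⇒⊆ : ∀ {m} {p q : Subset m} → p ⊑ q → p ⊆ q
⊑⇒⊆ {p = p} {q} h {x} i = lookup⇒[]= x q (h x ([]=⇒lookup i))

lookup-ext : ∀ {m} (p q : Subset m) → (∀ x → lookup p x ≡ lookup q x) → p ≡ q
lookup-ext p q h = trans (sym (tabulate∘lookup p)) (trans (tabulate-cong h) (tabulate∘lookup q))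

card-single-difference : ∀ {m} (p q : Subset m) x → (∀ v → ¬ v ≡ x → lookup p v ≡ lookup q v) →
           lookup p x ≡ true → lookup q x ≡ false → ∣ p ∣ ≡ suc ∣ q ∣
card-single-difference (a ∷ p) (b ∷ q) zero h pa qb rewrite pa | qb =
  cong suc (cong ∣_∣ (lookup-ext p q (λ v → h (suc v) (λ ()))))
card-single-difference (a ∷ p) (b ∷ q) (suc x) h pa qb with h zero (λ ())
card-single-difference (true ∷ p) (.true ∷ q) (suc x) h pa qb | refl =
  cong suc (card-single-difference p q x (λ v ne → h (suc v) (λ e → ne (Fin.suc-injective e))) pa qb)
card-single-difference (false ∷ p) (.false ∷ q) (suc x) h pa qb | refl =
  card-single-difference p q x (λ v ne → h (suc v) (λ e → ne (Fin.suc-injective e))) pa qb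

card-disjoint-union : ∀ {m} (Z A B : Subset m) → (∀ v → lookup Z v ≡ (lookup A v ∨ lookup B v)) →
            (∀ v → (lookup A v ∧ lookup B v) ≡ false) → ∣ A ∣ + ∣ B ∣ ≡ ∣ Z ∣
card-disjoint-union [] [] [] h d = refl
card-disjoint-union (z ∷ Z) (a ∷ A) (b ∷ B) h d with h zero | d zero
... | hz | dz with card-disjoint-union Z A B (λ v → h (suc v)) (λ v → d (suc v))
card-disjoint-union (.true ∷ Z) (true ∷ A) (false ∷ B) h d | refl | dz | r = cong suc r
card-disjoint-union (.true ∷ Z) (false ∷ A) (true ∷ B) h d | refl | dz | r = trans (+-suc ∣ A ∣ ∣ B ∣) (cong suc r)
card-disjoint-union (.false ∷ Z) (false ∷ A) (false ∷ B) h d | refl | dz | r = r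
card-disjoint-union (z ∷ Z) (true ∷ A) (true ∷ B) h d | hz | () | r

⊑⇒card≤ : ∀ {m} (p q : Subset m) → p ⊑ q → ∣ p ∣ ≤ ∣ q ∣
⊑⇒card≤ [] [] h = z≤n
⊑⇒card≤ (a ∷ p) (b ∷ q) h with ⊑⇒card≤ p q (λ x → h (suc x))
⊑⇒card≤ (true ∷ p) (b ∷ q) h | r with h zero refl
⊑⇒card≤ (true ∷ p) (.true ∷ q) h | r | refl = s≤s r
⊑⇒card≤ (false ∷ p) (true ∷ q) h | r = m≤n⇒m≤1+n r
⊑⇒card≤ (false ∷ p) (false ∷ q) h | r = r

⊑∧card≥⇒≡ : ∀ {m} (p q : Subset m) → p ⊑ q → ∣ q ∣ ≤ ∣ p ∣ → p ≡ q
⊑∧card≥⇒≡ [] [] h c = refl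
⊑∧card≥⇒≡ (true ∷ p) (b ∷ q) h c with h zero refl
⊑∧card≥⇒≡ (true ∷ p) (.true ∷ q) h (s≤s c) | refl = cong (true ∷_) (⊑∧card≥⇒≡ p q (λ x → h (suc x)) c)
⊑∧card≥⇒≡ (false ∷ p) (false ∷ q) h c = cong (false ∷_) (⊑∧card≥⇒≡ p q (λ x → h (suc x)) c)
⊑∧card≥⇒≡ (false ∷ p) (true ∷ q) h c =
  ⊥-elim (<-irrefl refl (≤-trans c (⊑⇒card≤ p q (λ x → h (suc x)))))

⊑-extra-element : ∀ {m} (p q : Subset m) → p ⊑ q → ∣ q ∣ ≡ suc ∣ p ∣ →
  Σ (Fin m) λ x → lookup q x ≡ true × lookup p x ≡ false × (∀ v → ¬ v ≡ x → lookup p v ≡ lookup q v)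
⊑-extra-element [] [] h ()
⊑-extra-element (true ∷ p) (b ∷ q) h c with h zero refl
⊑-extra-element (true ∷ p) (.true ∷ q) h c | refl with ⊑-extra-element p q (λ x → h (suc x)) (suc-injective c)
... | x , a , b , f = suc x , a , b , λ { zero _ → refl ; (suc v) ne → f v (λ e → ne (cong suc e)) }
⊑-extra-element (false ∷ p) (false ∷ q) h c with ⊑-extra-element p q (λ x → h (suc x)) c
... | x , a , b , f = suc x , a , b , λ { zero _ → refl ; (suc v) ne → f v (λ e → ne (cong suc e)) }
⊑-extra-element (false ∷ p) (true ∷ q) h c with ⊑∧card≥⇒≡ p q (λ x → h (suc x)) (≤-reflexive (suc-injective c))
... | refl = zero , refl , refl , λ { zero ne → ⊥-elim (ne refl) ; (suc v) _ → refl }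

nonempty-witness : ∀ {m} (p : Subset m) → 0 < ∣ p ∣ → Σ (Fin m) λ x → lookup p x ≡ true
nonempty-witness (true ∷ p) c = zero , refl
nonempty-witness (false ∷ p) c with nonempty-witness p c
... | x , e = suc x , e

card-++ : ∀ {a b} (A : Subset a) (B : Subset b) → ∣ A ++ B ∣ ≡ ∣ A ∣ + ∣ B ∣
card-++ [] B = refl
card-++ (true ∷ A) B = cong suc (card-++ A B)
card-++ (false ∷ A) B = card-++ A B

card≡0⇒empty : ∀ {m} (p : Subset m) → ∣ p ∣ ≡ 0 → ∀ v → lookup p v ≡ false
card≡0⇒empty (false ∷ p) h zero = refl
card≡0⇒empty (false ∷ p) h (suc v) = card≡0⇒empty p h v
card≡0⇒empty (true ∷ p) () v

eqb : ∀ {n} → Fin n → Fin n → Bool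
eqb a b = ⌊ a ≟F b ⌋

eqb-refl : ∀ {n} (a : Fin n) → eqb a a ≡ true
eqb-refl a with a ≟F a
... | yes _ = refl
... | no ne = ⊥-elim (ne refl)

eqb-ne : ∀ {n} {a b : Fin n} → ¬ a ≡ b → eqb a b ≡ false
eqb-ne {a = a} {b} ne with a ≟F b
... | yes e = ⊥-elim (ne e)
... | no _ = refl

sameSubset : ∀ {n} (A B : Subset n) → Bool
sameSubset A B = ⌊ ≡-decV _≟B_ A B ⌋

sameSubset-sound : ∀ {n} {A B : Subset n} → sameSubset A B ≡ true → A ≡ B
sameSubset-sound {A = A} {B} h with ≡-decV _≟B_ A B
... | yes e = e

sameSubset-refl : ∀ {n} (A : Subset n) → sameSubset A A ≡ true
sameSubset-refl A with ≡-decV _≟B_ A A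
... | yes _ = refl
... | no ne = ⊥-elim (ne refl)

module _ {n : ℕ} where

  sameSubset-complete : ∀ {A B : Subset n} → A ≡ B → sameSubset A B ≡ true
  sameSubset-complete {A} refl = sameSubset-refl A

  ≢-by-membership : ∀ (G : Subset n) {a b : Fin n} → lookup G a ≡ true → lookup G b ≡ false → ¬ a ≡ b
  ≢-by-membership G ha hb refl = bit-clash ha hb

  ⊑-suc-agree : ∀ (R G : Subset n) x → R ⊑ G → ∣ G ∣ ≡ suc ∣ R ∣ → lookup G x ≡ true → lookup R x ≡ false →
             ∀ v → ¬ v ≡ x → lookup G v ≡ lookup R v
  ⊑-suc-agree R G x sub cd gx rx v ne with ⊑-extra-element R G sub cd
  ... | y , gy , ry , agree with x ≟F y
  ... | yes refl = sym (agree v ne)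
  ... | no xy = ⊥-elim (true≢false (trans (sym (trans (agree x xy) gx)) rx))

  difference-witness : ∀ (A B : Subset n) → ∣ A ∣ ≡ ∣ B ∣ → ¬ A ≡ B → Σ (Fin n) λ v → lookup A v ≡ true × lookup B v ≡ false
  difference-witness A B cd ne with ¬∀⟶∃¬ n (λ v → (lookup A v ∧ not (lookup B v)) ≡ false) (λ v → (lookup A v ∧ not (lookup B v)) ≟B false) nosub
    where
    nosub : ¬ (∀ v → (lookup A v ∧ not (lookup B v)) ≡ false)
    nosub h = ne (⊑∧card≥⇒≡ A B sub (≤-reflexive (sym cd)))
      where
      sub : A ⊑ B
      sub v a with lookup B v in eq
      ... | true = refl
      ... | false = ⊥-elim (true≢false (subst₂ (λ x y → (x ∧ not y) ≡ false) a eq (h v)))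
  ... | v , nf = v , go (lookup A v) (lookup B v) nf
    where
    go : ∀ a b → ¬ (a ∧ not b) ≡ false → a ≡ true × b ≡ false
    go true false _ = refl , refl
    go true true h = ⊥-elim (h refl)
    go false b h = ⊥-elim (h refl)

  remove : Subset n → Fin n → Subset n
  remove G u = tabulate (λ v → lookup G v ∧ not (eqb v u))

  remove-lookup : ∀ (G : Subset n) u v → lookup (remove G u) v ≡ (lookup G v ∧ not (eqb v u))
  remove-lookup G u v = lookup∘tabulate _ v

  remove-self : ∀ (G : Subset n) u → lookup (remove G u) u ≡ false
  remove-self G u rewrite remove-lookup G u u | eqb-refl u = ∧-zeroʳ _

  remove-other : ∀ (G : Subset n) {u v} → ¬ v ≡ u → lookup (remove G u) v ≡ lookup G v
  remove-other G {u} {v} v≢u rewrite remove-lookup G u v | eqb-ne v≢u = ∧-identityʳ _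

  remove⁻ : ∀ (G : Subset n) u v → lookup (remove G u) v ≡ true → lookup G v ≡ true × ¬ v ≡ u
  remove⁻ G u v h with ∧not-true {lookup G v} (trans (sym (remove-lookup G u v)) h)
  ... | v∈G , v≠u = v∈G , λ { refl → bit-clash (eqb-refl v) v≠u }

  card-remove : ∀ (G : Subset n) u → lookup G u ≡ true → ∣ G ∣ ≡ suc ∣ remove G u ∣
  card-remove G u u∈G = card-single-difference G (remove G u) u (λ v v≢u → sym (remove-other G v≢u)) u∈G (remove-self G u)

  card-remove-≤ : ∀ (G : Subset n) u → ∣ G ∣ ≤ suc ∣ remove G u ∣
  card-remove-≤ G u with lookup G u in eq
  ... | true = ≤-reflexive (card-remove G u eq)
  ... | false = m≤n⇒m≤1+n (≤-reflexive (cong ∣_∣ (lookup-ext G (remove G u) unchanged)))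
    where
    unchanged : ∀ v → lookup G v ≡ lookup (remove G u) v
    unchanged v with v ≟F u
    ... | yes refl = trans eq (sym (remove-self G u))
    ... | no v≢u = sym (remove-other G v≢u)

  remove₂⁻ : ∀ (G : Subset n) {a b} v → lookup (remove (remove G a) b) v ≡ true → lookup G v ≡ true × ¬ v ≡ a × ¬ v ≡ b
  remove₂⁻ G {a} {b} v h with remove⁻ (remove G a) b v h
  ... | h′ , v≢b with remove⁻ G a v h′
  ...   | v∈G , v≢a = v∈G , v≢a , v≢b

  remove₂-other : ∀ (G : Subset n) {a b v} → ¬ v ≡ a → ¬ v ≡ b → lookup (remove (remove G a) b) v ≡ lookup G v
  remove₂-other G v≢a v≢b = trans (remove-other (remove G _) v≢b) (remove-other G v≢a)

  card-remove₂ : ∀ (G : Subset n) {a b} → lookup G a ≡ true → lookup G b ≡ true → ¬ b ≡ a →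
                 ∣ G ∣ ≡ suc (suc ∣ remove (remove G a) b ∣)
  card-remove₂ G {a} {b} a∈G b∈G b≢a =
    trans (card-remove G a a∈G) (cong suc (card-remove (remove G a) b (trans (remove-other G b≢a) b∈G)))

  card-with-apex : ∀ (Z A B : Subset n) w → lookup A w ≡ true → lookup B w ≡ true → lookup Z w ≡ false →
                   (∀ v → ¬ v ≡ w → lookup Z v ≡ (lookup A v ∨ lookup B v)) →
                   (∀ v → ¬ v ≡ w → (lookup A v ∧ lookup B v) ≡ false) → ∣ A ∣ + ∣ B ∣ ≡ suc (suc ∣ Z ∣)
  card-with-apex Z A B w w∈A w∈B w∉Z cover disjoint = begin
    ∣ A ∣ + ∣ B ∣                               ≡⟨ cong₂ _+_ (card-remove A w w∈A) (card-remove B w w∈B) ⟩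
    suc ∣ remove A w ∣ + suc ∣ remove B w ∣     ≡⟨ cong suc (+-suc _ _) ⟩
    suc (suc (∣ remove A w ∣ + ∣ remove B w ∣)) ≡⟨ cong (λ k → suc (suc k)) (card-disjoint-union Z (remove A w) (remove B w) cover′ disjoint′) ⟩
    suc (suc ∣ Z ∣)                             ∎
    where
    open ≡-Reasoning
    cover′ : ∀ v → lookup Z v ≡ (lookup (remove A w) v ∨ lookup (remove B w) v)
    cover′ v with v ≟F w
    ... | yes refl = trans w∉Z (sym (cong₂ _∨_ (remove-self A w) (remove-self B w)))
    ... | no v≢w = trans (cover v v≢w) (sym (cong₂ _∨_ (remove-other A v≢w) (remove-other B v≢w)))
    disjoint′ : ∀ v → (lookup (remove A w) v ∧ lookup (remove B w) v) ≡ false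
    disjoint′ v with v ≟F w
    ... | yes refl = cong₂ _∧_ (remove-self A w) (remove-self B w)
    ... | no v≢w = trans (cong₂ _∧_ (remove-other A v≢w) (remove-other B v≢w)) (disjoint v v≢w)

  pick-other : ∀ (A : Subset n) a → 2 ≤ ∣ A ∣ → Σ (Fin n) λ v → lookup A v ≡ true × ¬ v ≡ a
  pick-other A a h with nonempty-witness (remove A a) (≤-pred (≤-trans h (card-remove-≤ A a)))
  ... | v , m = v , remove⁻ A a v m

  pick-other₂ : ∀ (A : Subset n) a b → 3 ≤ ∣ A ∣ → Σ (Fin n) λ v → lookup A v ≡ true × ¬ v ≡ a × ¬ v ≡ b
  pick-other₂ A a b h with nonempty-witness (remove (remove A a) b)
         (≤-pred (≤-trans (≤-pred (≤-trans h (card-remove-≤ A a))) (card-remove-≤ (remove A a) b)))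
  ... | v , m = v , remove₂⁻ A v m

  update : Subset n → Fin n → Bool → Subset n
  update X w b = tabulate (λ v → if eqb v w then b else lookup X v)

  update-same : ∀ X w b → lookup (update X w b) w ≡ b
  update-same X w b rewrite lookup∘tabulate (λ v → if eqb v w then b else lookup X v) w | eqb-refl w = refl

  update-other : ∀ X w b v → ¬ v ≡ w → lookup (update X w b) v ≡ lookup X v
  update-other X w b v ne rewrite lookup∘tabulate (λ v → if eqb v w then b else lookup X v) v | eqb-ne ne = refl

-- Two copies of the vertex set

module Doubling (n : ℕ) where
  lowerCopy : Fin n → Fin (2 * n)
  lowerCopy v = v ↑ˡ (n + 0)
  upperCopy : Fin n → Fin (2 * n)
  upperCopy v = n ↑ʳ (v ↑ˡ 0)

  glue : Subset n → Subset n → Subset (2 * n)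
  glue A B = A ++ (B ++ [])

  lowerPart : Subset (2 * n) → Subset n
  lowerPart S = tabulate (λ v → lookup S (lowerCopy v))
  upperPart : Subset (2 * n) → Subset n
  upperPart S = tabulate (λ v → lookup S (upperCopy v))

  glue-lowerCopy : ∀ A B v → lookup (glue A B) (lowerCopy v) ≡ lookup A v
  glue-lowerCopy A B v = lookup-++ˡ A (B ++ []) v
  glue-upperCopy : ∀ A B v → lookup (glue A B) (upperCopy v) ≡ lookup B v
  glue-upperCopy A B v = trans (lookup-++ʳ A (B ++ []) (v ↑ˡ 0)) (lookup-++ˡ B [] v)

  lowerPart-lookup : ∀ S v → lookup (lowerPart S) v ≡ lookup S (lowerCopy v)
  lowerPart-lookup S v = lookup∘tabulate _ v
  upperPart-lookup : ∀ S v → lookup (upperPart S) v ≡ lookup S (upperCopy v)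
  upperPart-lookup S v = lookup∘tabulate _ v

  data CopyView : Fin (2 * n) → Set where
    inLower : ∀ v → CopyView (lowerCopy v)
    inUpper : ∀ v → CopyView (upperCopy v)

  copyView : ∀ i → CopyView i
  copyView i with splitAt n {n + 0} i in eq
  ... | inj₁ v rewrite sym (splitAt⁻¹-↑ˡ eq) = inLower v
  ... | inj₂ k with splitAt n {0} k in eq2
  ...   | inj₁ v rewrite sym (splitAt⁻¹-↑ʳ eq) | sym (splitAt⁻¹-↑ˡ eq2) = inUpper v
  ...   | inj₂ ()

  doubled-ext : ∀ (S T : Subset (2 * n)) → (∀ v → lookup S (lowerCopy v) ≡ lookup T (lowerCopy v)) →
         (∀ v → lookup S (upperCopy v) ≡ lookup T (upperCopy v)) → S ≡ T
  doubled-ext S T hl hh = lookup-ext S T f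
    where
    f : ∀ i → lookup S i ≡ lookup T i
    f i with copyView i
    ... | inLower v = hl v
    ... | inUpper v = hh v

  glue-parts : ∀ S → S ≡ glue (lowerPart S) (upperPart S)
  glue-parts S = doubled-ext S (glue (lowerPart S) (upperPart S)) (λ v → sym (trans (glue-lowerCopy (lowerPart S) (upperPart S) v) (lowerPart-lookup S v)))
                   (λ v → sym (trans (glue-upperCopy (lowerPart S) (upperPart S) v) (upperPart-lookup S v)))

  glue-injective : ∀ {A B A' B'} → glue A B ≡ glue A' B' → A ≡ A' × B ≡ B'
  glue-injective {A} {B} {A'} {B'} e =
    lookup-ext A A' (λ v → trans (sym (glue-lowerCopy A B v)) (trans (cong (λ S → lookup S (lowerCopy v)) e) (glue-lowerCopy A' B' v))) ,
    lookup-ext B B' (λ v → trans (sym (glue-upperCopy A B v)) (trans (cong (λ S → lookup S (upperCopy v)) e) (glue-upperCopy A' B' v)))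

  lowerPart-glue : ∀ A B → lowerPart (glue A B) ≡ A
  lowerPart-glue A B = lookup-ext (lowerPart (glue A B)) A (λ v → trans (lowerPart-lookup (glue A B) v) (glue-lowerCopy A B v))
  upperPart-glue : ∀ A B → upperPart (glue A B) ≡ B
  upperPart-glue A B = lookup-ext (upperPart (glue A B)) B (λ v → trans (upperPart-lookup (glue A B) v) (glue-upperCopy A B v))

  card-glue : ∀ (A B : Subset n) → ∣ glue A B ∣ ≡ ∣ A ∣ + ∣ B ∣
  card-glue A B = trans (card-++ A (B ++ [])) (cong (∣ A ∣ +_) (trans (card-++ B []) (+-identityʳ _)))

  ⊑-from-parts : ∀ {S T : Subset (2 * n)} → lowerPart S ⊑ lowerPart T → upperPart S ⊑ upperPart T → S ⊑ T
  ⊑-from-parts {S} {T} hl hh i e with copyView i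
  ... | inLower v = trans (sym (lowerPart-lookup T v)) (hl v (trans (lowerPart-lookup S v) e))
  ... | inUpper v = trans (sym (upperPart-lookup T v)) (hh v (trans (upperPart-lookup S v) e))

  lowerCopy≢upperCopy : ∀ v u → ¬ lowerCopy v ≡ upperCopy u
  lowerCopy≢upperCopy v u e = <⇒≢ (≤-trans (toℕ<n v) (m≤m+n n _)) (trans (sym (toℕ-↑ˡ v (n + 0))) (trans (cong toℕ e) (toℕ-↑ʳ n (u ↑ˡ 0))))

-- Ridges as facets with one vertex copy deleted

sideAt : ∀ {n} → Bool → Subset n → Subset n → Fin n → Bool
sideAt false A B v = lookup A v
sideAt true A B v = lookup B v

-- (RA, RB) is the ridge of the facet (SA, SB) obtained by deleting copy c of vertex u;
-- copy false is the lower one.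
record Extends {n} (RA RB SA SB : Subset n) (u : Fin n) (c : Bool) : Set where
  constructor mkExtends
  field
    agree : ∀ v → ¬ v ≡ u → lookup SA v ≡ lookup RA v × lookup SB v ≡ lookup RB v
    added : sideAt c SA SB u ≡ true
    absent : sideAt c RA RB u ≡ false
    other-side : sideAt (not c) SA SB u ≡ sideAt (not c) RA RB u

module _ {n : ℕ} where
  open Doubling n

  SameAt : (KA KB HA HB : Subset n) → Fin n → Set
  SameAt KA KB HA HB v = lookup KA v ≡ lookup HA v × lookup KB v ≡ lookup HB v

  other-side-empty : ∀ c (A B : Subset n) v → (lookup A v ∧ lookup B v) ≡ false → sideAt c A B v ≡ true → sideAt (not c) A B v ≡ false
  other-side-empty false A B v h s rewrite s = h
  other-side-empty true A B v h s rewrite s = trans (sym (∧-identityʳ _)) h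

  both-sides-false : ∀ c (A B : Subset n) v → sideAt c A B v ≡ false → sideAt (not c) A B v ≡ false → lookup A v ≡ false × lookup B v ≡ false
  both-sides-false false A B v h1 h2 = h1 , h2
  both-sides-false true A B v h1 h2 = h2 , h1

  sideAt⇒∨ : ∀ c (A B : Subset n) v → sideAt c A B v ≡ true → (lookup A v ∨ lookup B v) ≡ true
  sideAt⇒∨ false A B v h rewrite h = refl
  sideAt⇒∨ true A B v h rewrite h = ∨-zeroʳ _

  sideAt-double : ∀ (A B : Subset n) v → lookup A v ≡ true → lookup B v ≡ true → ∀ c → sideAt c A B v ≡ true
  sideAt-double A B v a b false = a
  sideAt-double A B v a b true = b

  sideAt-agree : ∀ (A B A' B' : Subset n) v → SameAt A B A' B' v → ∀ c → sideAt c A B v ≡ sideAt c A' B' v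
  sideAt-agree A B A' B' v (p , q) false = p
  sideAt-agree A B A' B' v (p , q) true = q

  opposite-sides : ∀ a b (A B : Subset n) v → sideAt a A B v ≡ true → sideAt b A B v ≡ false → b ≡ not a
  opposite-sides false false A B v h1 h2 = ⊥-elim (bit-clash h1 h2)
  opposite-sides false true A B v h1 h2 = refl
  opposite-sides true false A B v h1 h2 = refl
  opposite-sides true true A B v h1 h2 = ⊥-elim (bit-clash h1 h2)

  ∨-false : ∀ (A B : Subset n) v → lookup A v ≡ false × lookup B v ≡ false → (lookup A v ∨ lookup B v) ≡ false
  ∨-false A B v (a , b) rewrite a | b = refl

  disjoint-clash : ∀ {A B : Subset n} {v} → lookup A v ≡ true → lookup B v ≡ true → (lookup A v ∧ lookup B v) ≡ false → ⊥
  disjoint-clash a b h rewrite a | b = true≢false h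

  support-agree : ∀ (A B A' B' : Subset n) v → SameAt A B A' B' v → (lookup A v ∨ lookup B v) ≡ (lookup A' v ∨ lookup B' v)
  support-agree A B A' B' v (p , q) = cong₂ _∨_ p q

  SameAt-trans : ∀ {A B A' B' A'' B'' : Subset n} {v} → SameAt A B A' B' v → SameAt A' B' A'' B'' v → SameAt A B A'' B'' v
  SameAt-trans (p , q) (p' , q') = trans p p' , trans q q'

  SameAt-sym : ∀ {A B A' B' : Subset n} {v} → SameAt A B A' B' v → SameAt A' B' A B v
  SameAt-sym (p , q) = sym p , sym q

  SameAt-from-sides : ∀ c (A B A' B' : Subset n) v → sideAt c A B v ≡ sideAt c A' B' v → sideAt (not c) A B v ≡ sideAt (not c) A' B' v →
                 SameAt A B A' B' v
  SameAt-from-sides false A B A' B' v p q = p , q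
  SameAt-from-sides true A B A' B' v p q = q , p

  same-point? : ∀ (u u'' : Fin n) c c'' → (u'' ≡ u × c'' ≡ c) ⊎ ¬ (u'' ≡ u × c'' ≡ c)
  same-point? u u'' c c'' with u'' ≟F u | c'' ≟B c
  ... | yes a | yes b = inj₁ (a , b)
  ... | no a | _ = inj₂ (λ p → a (proj₁ p))
  ... | yes _ | no b = inj₂ (λ p → b (proj₂ p))

  Extends⇒⊑ : ∀ {RA RB SA SB : Subset n} {u c} → Extends RA RB SA SB u c → RA ⊑ SA × RB ⊑ SB
  Extends⇒⊑ {RA} {RB} {SA} {SB} {u} {false} (mkExtends agree added absent other-side) = fa , fb
    where
    fa : RA ⊑ SA
    fa v h with v ≟F u
    ... | no ne = trans (proj₁ (agree v ne)) h
    ... | yes refl = ⊥-elim (true≢false (trans (sym h) absent))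
    fb : RB ⊑ SB
    fb v h with v ≟F u
    ... | no ne = trans (proj₂ (agree v ne)) h
    ... | yes refl = trans other-side h
  Extends⇒⊑ {RA} {RB} {SA} {SB} {u} {true} (mkExtends agree added absent other-side) = fa , fb
    where
    fa : RA ⊑ SA
    fa v h with v ≟F u
    ... | no ne = trans (proj₁ (agree v ne)) h
    ... | yes refl = trans other-side h
    fb : RB ⊑ SB
    fb v h with v ≟F u
    ... | no ne = trans (proj₂ (agree v ne)) h
    ... | yes refl = ⊥-elim (true≢false (trans (sym h) absent))

  Extends-card : ∀ {RA RB SA SB : Subset n} {u c} → Extends RA RB SA SB u c → ∣ SA ∣ + ∣ SB ∣ ≡ suc (∣ RA ∣ + ∣ RB ∣)
  Extends-card {RA} {RB} {SA} {SB} {u} {false} (mkExtends agree added absent other-side) =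
    trans (cong (_+ ∣ SB ∣) (card-single-difference SA RA u (λ v ne → proj₁ (agree v ne)) added absent))
          (cong (λ t → suc (∣ RA ∣ + t)) (cong ∣_∣ (lookup-ext SB RB f)))
    where
    f : ∀ v → lookup SB v ≡ lookup RB v
    f v with v ≟F u
    ... | yes refl = other-side
    ... | no ne = proj₂ (agree v ne)
  Extends-card {RA} {RB} {SA} {SB} {u} {true} (mkExtends agree added absent other-side) =
    trans (cong (∣ SA ∣ +_) (card-single-difference SB RB u (λ v ne → proj₂ (agree v ne)) added absent))
          (trans (+-suc _ _) (cong (λ t → suc (t + ∣ RB ∣)) (cong ∣_∣ (lookup-ext SA RA f))))
    where
    f : ∀ v → lookup SA v ≡ lookup RA v
    f v with v ≟F u
    ... | yes refl = other-side
    ... | no ne = proj₁ (agree v ne)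

  Extends-deterministic : ∀ {RA RB SA SB TA TB : Subset n} {u c} → Extends RA RB SA SB u c → Extends RA RB TA TB u c → SA ≡ TA × SB ≡ TB
  Extends-deterministic {RA} {RB} {SA} {SB} {TA} {TB} {u} {false} (mkExtends o1 s1 r1 k1) (mkExtends o2 s2 r2 k2) = lookup-ext SA TA fa , lookup-ext SB TB fb
    where
    fa : ∀ v → lookup SA v ≡ lookup TA v
    fa v with v ≟F u
    ... | no ne = trans (proj₁ (o1 v ne)) (sym (proj₁ (o2 v ne)))
    ... | yes refl = trans s1 (sym s2)
    fb : ∀ v → lookup SB v ≡ lookup TB v
    fb v with v ≟F u
    ... | no ne = trans (proj₂ (o1 v ne)) (sym (proj₂ (o2 v ne)))
    ... | yes refl = trans k1 (sym k2)
  Extends-deterministic {RA} {RB} {SA} {SB} {TA} {TB} {u} {true} (mkExtends o1 s1 r1 k1) (mkExtends o2 s2 r2 k2) = lookup-ext SA TA fa , lookup-ext SB TB fb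
    where
    fa : ∀ v → lookup SA v ≡ lookup TA v
    fa v with v ≟F u
    ... | no ne = trans (proj₁ (o1 v ne)) (sym (proj₁ (o2 v ne)))
    ... | yes refl = trans k1 (sym k2)
    fb : ∀ v → lookup SB v ≡ lookup TB v
    fb v with v ≟F u
    ... | no ne = trans (proj₂ (o1 v ne)) (sym (proj₂ (o2 v ne)))
    ... | yes refl = trans s1 (sym s2)

  Extends-point-unique : ∀ {RA RB SA SB : Subset n} {u c u' c'} → Extends RA RB SA SB u c → Extends RA RB SA SB u' c' → u ≡ u' × c ≡ c'
  Extends-point-unique {RA} {RB} {SA} {SB} {u} {c} {u'} {c'} (mkExtends o1 s1 r1 k1) (mkExtends o2 s2 r2 k2) with u ≟F u'
  ... | no ne = ⊥-elim (true≢false (trans (sym s1) (trans (sd c) r1)))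
    where
    sd : ∀ c → sideAt c SA SB u ≡ sideAt c RA RB u
    sd false = proj₁ (o2 u ne)
    sd true = proj₂ (o2 u ne)
  ... | yes refl with c ≟B c'
  ... | yes e = refl , e
  ... | no ne rewrite ¬-not {c'} {c} (λ e → ne (sym e)) = ⊥-elim (true≢false (trans (sym s2) (trans k1 r2)))

  Extends-agree : ∀ {RA RB KA KB HA HB : Subset n} {u c u' c'} → Extends RA RB KA KB u c → Extends RA RB HA HB u' c' →
        ∀ v → ¬ v ≡ u → ¬ v ≡ u' → SameAt KA KB HA HB v
  Extends-agree (mkExtends oK _ _ _) (mkExtends oH _ _ _) v n1 n2 = trans (proj₁ (oK v n1)) (sym (proj₁ (oH v n2))) , trans (proj₂ (oK v n1)) (sym (proj₂ (oH v n2)))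

  Extends-absent : ∀ {RA RB KA KB : Subset n} {u c} → Extends RA RB KA KB u c → (lookup KA u ∧ lookup KB u) ≡ false →
            lookup RA u ≡ false × lookup RB u ≡ false
  Extends-absent {RA} {RB} {KA} {KB} {u} {c} (mkExtends _ s r k) disjoint = both-sides-false c RA RB u r (trans (sym k) (other-side-empty c KA KB u disjoint s))

  Extends-elsewhere : ∀ {RA RB HA HB : Subset n} {u u' c'} → Extends RA RB HA HB u' c' → ¬ u ≡ u' → lookup HA u ≡ lookup RA u × lookup HB u ≡ lookup RB u
  Extends-elsewhere (mkExtends o _ _ _) ne = o _ ne

  Extends-double : ∀ {RA RB KA KB : Subset n} {u c} → Extends RA RB KA KB u c → lookup KA u ≡ true → lookup KB u ≡ true →
             sideAt (not c) RA RB u ≡ true × sideAt c RA RB u ≡ false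
  Extends-double {RA} {RB} {KA} {KB} {u} {false} (mkExtends _ s r k) a b = trans (sym k) b , r
  Extends-double {RA} {RB} {KA} {KB} {u} {true} (mkExtends _ s r k) a b = trans (sym k) a , r

  Extends-single : ∀ {RA RB TA TB : Subset n} p b → (∀ v → ¬ v ≡ p → SameAt TA TB RA RB v) →
    sideAt b TA TB p ≡ true → (lookup TA p ∧ lookup TB p) ≡ false → lookup RA p ≡ false → lookup RB p ≡ false → Extends RA RB TA TB p b
  Extends-single {RA} {RB} {TA} {TB} p b o s i ra rb = mkExtends o s (absent b) (trans (other-side-empty b TA TB p i s) (sym (absent (not b))))
    where
    absent : ∀ b → sideAt b RA RB p ≡ false
    absent false = ra
    absent true = rb

  Extends-onto-double : ∀ {RA RB TA TB : Subset n} p b → (∀ v → ¬ v ≡ p → SameAt TA TB RA RB v) →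
    lookup TA p ≡ true → lookup TB p ≡ true → sideAt b RA RB p ≡ false → sideAt (not b) RA RB p ≡ true → Extends RA RB TA TB p b
  Extends-onto-double {RA} {RB} {TA} {TB} p b o ta tb r k = mkExtends o (sideAt-double TA TB p ta tb b) r (trans (sideAt-double TA TB p ta tb (not b)) (sym k))

  removeLower : Subset n → Fin n → Bool → Subset n
  removeLower A u c = tabulate (λ v → lookup A v ∧ not (eqb v u ∧ not c))

  removeUpper : Subset n → Fin n → Bool → Subset n
  removeUpper B u c = tabulate (λ v → lookup B v ∧ not (eqb v u ∧ c))

  remove-Extends : ∀ (A B : Subset n) u c → sideAt c A B u ≡ true → Extends (removeLower A u c) (removeUpper B u c) A B u c
  remove-Extends A B u c h = mkExtends agree h (absent c) (other-side′ c)
    where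
    agree : ∀ v → ¬ v ≡ u → lookup A v ≡ lookup (removeLower A u c) v × lookup B v ≡ lookup (removeUpper B u c) v
    agree v ne rewrite lookup∘tabulate (λ v → lookup A v ∧ not (eqb v u ∧ not c)) v
                   | lookup∘tabulate (λ v → lookup B v ∧ not (eqb v u ∧ c)) v | eqb-ne ne
      = sym (∧-identityʳ _) , sym (∧-identityʳ _)
    absent : ∀ c → sideAt c (removeLower A u c) (removeUpper B u c) u ≡ false
    absent false rewrite lookup∘tabulate (λ v → lookup A v ∧ not (eqb v u ∧ true)) u | eqb-refl u = ∧-zeroʳ _
    absent true rewrite lookup∘tabulate (λ v → lookup B v ∧ not (eqb v u ∧ true)) u | eqb-refl u = ∧-zeroʳ _
    other-side′ : ∀ c → sideAt (not c) A B u ≡ sideAt (not c) (removeLower A u c) (removeUpper B u c) u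
    other-side′ false rewrite lookup∘tabulate (λ v → lookup B v ∧ not (eqb v u ∧ false)) u | eqb-refl u = sym (∧-identityʳ _)
    other-side′ true rewrite lookup∘tabulate (λ v → lookup A v ∧ not (eqb v u ∧ false)) u | eqb-refl u = sym (∧-identityʳ _)

  ⊑-suc⇒Extends : ∀ (R K : Subset (2 * n)) → R ⊑ K → ∣ K ∣ ≡ suc ∣ R ∣ →
    Σ (Fin n) λ u → Σ Bool λ c → Extends (lowerPart R) (upperPart R) (lowerPart K) (upperPart K) u c
  ⊑-suc⇒Extends R K sub cd with ⊑-extra-element R K sub cd
  ... | x , kx , rx , agree with copyView x
  ... | inLower u = u , false , mkExtends o (trans (lowerPart-lookup K u) kx) (trans (lowerPart-lookup R u) rx)
          (trans (upperPart-lookup K u) (trans (sym (agree (upperCopy u) (λ e → lowerCopy≢upperCopy u u (sym e)))) (sym (upperPart-lookup R u))))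
    where
    o : ∀ v → ¬ v ≡ u → lookup (lowerPart K) v ≡ lookup (lowerPart R) v × lookup (upperPart K) v ≡ lookup (upperPart R) v
    o v ne = trans (lowerPart-lookup K v) (trans (sym (agree (lowerCopy v) (λ e → ne (lowerCopy-injective e)))) (sym (lowerPart-lookup R v))) ,
             trans (upperPart-lookup K v) (trans (sym (agree (upperCopy v) (λ e → lowerCopy≢upperCopy u v (sym e)))) (sym (upperPart-lookup R v)))
      where
      lowerCopy-injective : lowerCopy v ≡ lowerCopy u → v ≡ u
      lowerCopy-injective e = Fin.↑ˡ-injective _ v u e
  ... | inUpper u = u , true , mkExtends o (trans (upperPart-lookup K u) kx) (trans (upperPart-lookup R u) rx)
          (trans (lowerPart-lookup K u) (trans (sym (agree (lowerCopy u) (λ e → lowerCopy≢upperCopy u u e))) (sym (lowerPart-lookup R u))))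
    where
    o : ∀ v → ¬ v ≡ u → lookup (lowerPart K) v ≡ lookup (lowerPart R) v × lookup (upperPart K) v ≡ lookup (upperPart R) v
    o v ne = trans (lowerPart-lookup K v) (trans (sym (agree (lowerCopy v) (λ e → lowerCopy≢upperCopy v u e))) (sym (lowerPart-lookup R v))) ,
             trans (upperPart-lookup K v) (trans (sym (agree (upperCopy v) (λ e → ne (upperCopy-injective e)))) (sym (upperPart-lookup R v)))
      where
      upperCopy-injective : upperCopy v ≡ upperCopy u → v ≡ u
      upperCopy-injective e = Fin.↑ˡ-injective 0 v u (Fin.↑ʳ-injective n _ _ e)

-- Walks in a dual graph

module Walks {n : ℕ} (d : ℕ) (C : Complex n) where

  walk-++ : ∀ {A B D k m} → Walk d C A B k → Walk d C B D m → Walk d C A D (k + m)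
  walk-++ (here _) v = v
  walk-++ (step a u) v = step a (walk-++ u v)

  adjacent-sym : ∀ {S T} → Adjacent d C S T → Adjacent d C T S
  adjacent-sym (a , b , ne , R , c , s , t) = b , a , (λ e → ne (sym e)) , R , c , t , s

  walk-reverse : ∀ {S T k} → Walk d C S T k → Walk d C T S k
  walk-reverse (here h) = here h
  walk-reverse {k = suc k} (step a w) = subst (Walk d C _ _) (+-comm k 1) (walk-++ (walk-reverse w) (step (adjacent-sym a) (here (proj₁ a))))

  walk-start∈ : ∀ {A B k} → Walk d C A B k → A ∈C C
  walk-start∈ (here h) = h
  walk-start∈ (step a _) = proj₁ a

  facetAt : ∀ {A B k} → Walk d C A B k → ℕ → Subset n
  facetAt {A = A} (here _) _ = A
  facetAt {A = A} (step _ w) zero = A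
  facetAt (step _ w) (suc i) = facetAt w i

  facetAt-0 : ∀ {A B k} (w : Walk d C A B k) → facetAt w 0 ≡ A
  facetAt-0 (here _) = refl
  facetAt-0 (step _ _) = refl

  facetAt∈ : ∀ {A B k} (w : Walk d C A B k) i → i ≤ k → facetAt w i ∈C C
  facetAt∈ (here h) i _ = h
  facetAt∈ (step a w) zero _ = proj₁ a
  facetAt∈ (step a w) (suc i) (s≤s le) = facetAt∈ w i le

  facetAt-adjacent : ∀ {A B k} (w : Walk d C A B k) i → suc i ≤ k → Adjacent d C (facetAt w i) (facetAt w (suc i))
  facetAt-adjacent (step a w) zero _ = subst (Adjacent d C _) (sym (facetAt-0 w)) a
  facetAt-adjacent (step a w) (suc i) (s≤s le) = facetAt-adjacent w i le

  walk-prefix : ∀ {A B k} (w : Walk d C A B k) i → i ≤ k → Walk d C A (facetAt w i) i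
  walk-prefix w zero _ = subst (λ X → Walk d C _ X 0) (sym (facetAt-0 w)) (here (walk-start∈ w))
  walk-prefix (step a w) (suc i) (s≤s le) = step a (walk-prefix w i le)

  walk-suffix : ∀ {A B k} (w : Walk d C A B k) i → i ≤ k → Walk d C (facetAt w i) B (k ∸ i)
  walk-suffix (here h) zero _ = here h
  walk-suffix (step a w) zero _ = step a w
  walk-suffix (step a w) (suc i) (s≤s le) = walk-suffix w i le

  Reachable : Subset n → Subset n → Set
  Reachable S T = Σ ℕ λ k → Walk d C S T k

  reachable-refl : ∀ {S} → S ∈C C → Reachable S S
  reachable-refl h = 0 , here h

  reachable-adjacent : ∀ {S T} → Adjacent d C S T → Reachable S T
  reachable-adjacent a = 1 , step a (here (proj₁ (proj₂ a)))

  reachable-trans : ∀ {S T U} → Reachable S T → Reachable T U → Reachable S U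
  reachable-trans (k , w) (m , w') = k + m , walk-++ w w'

  reachable-sym : ∀ {S T} → Reachable S T → Reachable T S
  reachable-sym (k , w) = k , walk-reverse w

-- The pseudo-manifold built along a shortest path

-- e 0, ℓ δ and the cap apexes wL, wR are auxiliary vertices chosen at the two ends.
record GeodesicPath (n d : ℕ) : Set where
  field
    δ : ℕ
    F : ℕ → Subset n
    e ℓ : ℕ → Fin n
    wL wR : Fin n
    ∣F∣≡d : ∀ i → i ≤ δ → ∣ F i ∣ ≡ d
    e∈ : ∀ i → i ≤ δ → lookup (F i) (e i) ≡ true
    ℓ∈ : ∀ i → i ≤ δ → lookup (F i) (ℓ i) ≡ true
    e≢ℓ : ∀ i → i ≤ δ → ¬ e i ≡ ℓ i
    F-step : ∀ i → i < δ → ∀ v → ¬ v ≡ ℓ i → ¬ v ≡ e (suc i) → lookup (F i) v ≡ lookup (F (suc i)) v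
    ℓ∉ : ∀ i → i < δ → lookup (F (suc i)) (ℓ i) ≡ false
    e∉ : ∀ i → i < δ → lookup (F i) (e (suc i)) ≡ false
    geodesic : ∀ i j → i ≤ δ → j ≤ δ → (U : Subset n) → suc ∣ U ∣ ≡ d → U ⊑ F i → U ⊑ F j → j ≤ suc i
    F-injective : ∀ i j → i ≤ δ → j ≤ δ → F i ≡ F j → i ≡ j
    wL∈ : lookup (F 0) wL ≡ true
    wL≢e : ¬ wL ≡ e 0
    wR∈ : lookup (F δ) wR ≡ true
    wR≢ℓ : ¬ wR ≡ ℓ δ
    wL≢wR : ¬ wL ≡ wR

module Construction {n d : ℕ} (π : GeodesicPath n d) where
  open GeodesicPath π
  open Doubling n

  ZL : Subset n
  ZL = remove (remove (F 0) (e 0)) wL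

  ZR : Subset n
  ZR = remove (remove (F δ) (ℓ δ)) wR

  wL∉ZL : lookup ZL wL ≡ false
  wL∉ZL = remove-self (remove (F 0) (e 0)) wL

  wR∉ZR : lookup ZR wR ≡ false
  wR∉ZR = remove-self (remove (F δ) (ℓ δ)) wR

  ZL⁻ : ∀ v → lookup ZL v ≡ true → lookup (F 0) v ≡ true × ¬ v ≡ e 0 × ¬ v ≡ wL
  ZL⁻ = remove₂⁻ (F 0) {e 0} {wL}

  ZR⁻ : ∀ v → lookup ZR v ≡ true → lookup (F δ) v ≡ true × ¬ v ≡ ℓ δ × ¬ v ≡ wR
  ZR⁻ = remove₂⁻ (F δ) {ℓ δ} {wR}

  ZL-lookup-off : ∀ v → ¬ v ≡ e 0 → ¬ v ≡ wL → lookup ZL v ≡ lookup (F 0) v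
  ZL-lookup-off v = remove₂-other (F 0) {e 0} {wL}

  ZR-lookup-off : ∀ v → ¬ v ≡ ℓ δ → ¬ v ≡ wR → lookup ZR v ≡ lookup (F δ) v
  ZR-lookup-off v = remove₂-other (F δ) {ℓ δ} {wR}

  ZL⁺ : ∀ v → lookup (F 0) v ≡ true → ¬ v ≡ e 0 → ¬ v ≡ wL → lookup ZL v ≡ true
  ZL⁺ v v∈F v≢e v≢w = trans (ZL-lookup-off v v≢e v≢w) v∈F

  ZR⁺ : ∀ v → lookup (F δ) v ≡ true → ¬ v ≡ ℓ δ → ¬ v ≡ wR → lookup ZR v ≡ true
  ZR⁺ v v∈F v≢ℓ v≢w = trans (ZR-lookup-off v v≢ℓ v≢w) v∈F

  card-ZL : ∣ F 0 ∣ ≡ suc (suc ∣ ZL ∣)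
  card-ZL = card-remove₂ (F 0) (e∈ 0 z≤n) wL∈ wL≢e

  card-ZR : ∣ F δ ∣ ≡ suc (suc ∣ ZR ∣)
  card-ZR = card-remove₂ (F δ) (ℓ∈ δ ≤-refl) wR∈ (λ eq → wR≢ℓ eq)

  -- A facet of P is a pair (lower part, upper part); X marks the vertices taken in the upper copy.
  data Code : Set where
    tube : ℕ → Subset n → Code
    capL : Subset n → Code
    capR : Subset n → Code

  Valid : Code → Set
  Valid (tube j X) = j ≤ δ × lookup X (ℓ j) ≡ lookup X (e j)
  Valid (capL X) = ⊤
  Valid (capR X) = ⊤

  opaque
    lowerOf : Code → Subset n
    lowerOf (tube j X) = tabulate (λ v → lookup (F j) v ∧ not (lookup X v))
    lowerOf (capL X) = tabulate (λ v → (lookup ZL v ∧ not (lookup X v)) ∨ eqb v wL)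
    lowerOf (capR X) = tabulate (λ v → (lookup ZR v ∧ not (lookup X v)) ∨ eqb v wR)
    upperOf : Code → Subset n
    upperOf (tube j X) = tabulate (λ v → lookup (F j) v ∧ lookup X v)
    upperOf (capL X) = tabulate (λ v → (lookup ZL v ∧ lookup X v) ∨ eqb v wL)
    upperOf (capR X) = tabulate (λ v → (lookup ZR v ∧ lookup X v) ∨ eqb v wR)

  facet : Code → Subset (2 * n)
  facet D = glue (lowerOf D) (upperOf D)

  level : Code → ℕ
  level (tube j X) = suc j
  level (capL X) = 0
  level (capR X) = suc (suc δ)

  -- Membership is decided through the fact that a facet (A, B) is the one coded by its upper part B.
  isTube : ℕ → Subset n → Subset n → Bool
  isTube j A B = sameSubset A (lowerOf (tube j B)) ∧ sameSubset B (upperOf (tube j B)) ∧ ⌊ lookup B (ℓ j) ≟B lookup B (e j) ⌋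
  isCapL : Subset n → Subset n → Bool
  isCapL A B = sameSubset A (lowerOf (capL B)) ∧ sameSubset B (upperOf (capL B))
  isCapR : Subset n → Subset n → Bool
  isCapR A B = sameSubset A (lowerOf (capR B)) ∧ sameSubset B (upperOf (capR B))

  isFacetPair : Subset n → Subset n → Bool
  isFacetPair A B = any≤ δ (λ j → isTube j A B) ∨ isCapL A B ∨ isCapR A B

  P : Complex (2 * n)
  P S = isFacetPair (lowerPart S) (upperPart S)

  opaque
    unfolding lowerOf upperOf
    tube-lower : ∀ j X v → lookup (lowerOf (tube j X)) v ≡ (lookup (F j) v ∧ not (lookup X v))
    tube-lower j X v = lookup∘tabulate _ v
    tube-upper : ∀ j X v → lookup (upperOf (tube j X)) v ≡ (lookup (F j) v ∧ lookup X v)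
    tube-upper j X v = lookup∘tabulate _ v
    capL-lower : ∀ X v → lookup (lowerOf (capL X)) v ≡ ((lookup ZL v ∧ not (lookup X v)) ∨ eqb v wL)
    capL-lower X v = lookup∘tabulate _ v
    capL-upper : ∀ X v → lookup (upperOf (capL X)) v ≡ ((lookup ZL v ∧ lookup X v) ∨ eqb v wL)
    capL-upper X v = lookup∘tabulate _ v
    capR-lower : ∀ X v → lookup (lowerOf (capR X)) v ≡ ((lookup ZR v ∧ not (lookup X v)) ∨ eqb v wR)
    capR-lower X v = lookup∘tabulate _ v
    capR-upper : ∀ X v → lookup (upperOf (capR X)) v ≡ ((lookup ZR v ∧ lookup X v) ∨ eqb v wR)
    capR-upper X v = lookup∘tabulate _ v


  tube-canonical : ∀ j X → lowerOf (tube j (upperOf (tube j X))) ≡ lowerOf (tube j X) × upperOf (tube j (upperOf (tube j X))) ≡ upperOf (tube j X)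
  tube-canonical j X = lookup-ext _ _ (λ v → trans (tube-lower j (upperOf (tube j X)) v) (trans (cong (λ t → lookup (F j) v ∧ not t) (tube-upper j X v))
                         (trans (∧-not-absorb (lookup (F j) v) (lookup X v)) (sym (tube-lower j X v))))) ,
               lookup-ext _ _ (λ v → trans (tube-upper j (upperOf (tube j X)) v) (trans (cong (λ t → lookup (F j) v ∧ t) (tube-upper j X v))
                         (trans (∧-absorb (lookup (F j) v) (lookup X v)) (sym (tube-upper j X v)))))
  capL-canonical : ∀ X → lowerOf (capL (upperOf (capL X))) ≡ lowerOf (capL X) × upperOf (capL (upperOf (capL X))) ≡ upperOf (capL X)
  capL-canonical X = lookup-ext _ _ (λ v → trans (capL-lower (upperOf (capL X)) v) (trans (cong (λ t → (lookup ZL v ∧ not t) ∨ eqb v wL) (capL-upper X v))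
                         (trans (∨-∧-not-absorb (lookup ZL v) (lookup X v) (eqb v wL)) (sym (capL-lower X v))))) ,
             lookup-ext _ _ (λ v → trans (capL-upper (upperOf (capL X)) v) (trans (cong (λ t → (lookup ZL v ∧ t) ∨ eqb v wL) (capL-upper X v))
                         (trans (∨-∧-absorb (lookup ZL v) (lookup X v) (eqb v wL)) (sym (capL-upper X v)))))
  capR-canonical : ∀ X → lowerOf (capR (upperOf (capR X))) ≡ lowerOf (capR X) × upperOf (capR (upperOf (capR X))) ≡ upperOf (capR X)
  capR-canonical X = lookup-ext _ _ (λ v → trans (capR-lower (upperOf (capR X)) v) (trans (cong (λ t → (lookup ZR v ∧ not t) ∨ eqb v wR) (capR-upper X v))
                         (trans (∨-∧-not-absorb (lookup ZR v) (lookup X v) (eqb v wR)) (sym (capR-lower X v))))) ,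
             lookup-ext _ _ (λ v → trans (capR-upper (upperOf (capR X)) v) (trans (cong (λ t → (lookup ZR v ∧ t) ∨ eqb v wR) (capR-upper X v))
                         (trans (∨-∧-absorb (lookup ZR v) (lookup X v) (eqb v wR)) (sym (capR-upper X v)))))

  facet∈P : ∀ D → Valid D → P (facet D) ≡ true
  facet∈P D v rewrite lowerPart-glue (lowerOf D) (upperOf D) | upperPart-glue (lowerOf D) (upperOf D) = go D v
    where
    go : ∀ D → Valid D → isFacetPair (lowerOf D) (upperOf D) ≡ true
    go (tube j X) (le , c) =
      cong (_∨ (isCapL (lowerOf (tube j X)) (upperOf (tube j X)) ∨ isCapR (lowerOf (tube j X)) (upperOf (tube j X))))
        (any≤-complete δ _ j le tt') 
      where
      cc : lookup (upperOf (tube j X)) (ℓ j) ≡ lookup (upperOf (tube j X)) (e j)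
      cc rewrite tube-upper j X (ℓ j) | tube-upper j X (e j) | ℓ∈ j le | e∈ j le = c
      dd : ⌊ lookup (upperOf (tube j X)) (ℓ j) ≟B lookup (upperOf (tube j X)) (e j) ⌋ ≡ true
      dd with lookup (upperOf (tube j X)) (ℓ j) ≟B lookup (upperOf (tube j X)) (e j)
      ... | yes _ = refl
      ... | no ne = ⊥-elim (ne cc)
      tt' : isTube j (lowerOf (tube j X)) (upperOf (tube j X)) ≡ true
      tt' rewrite sameSubset-complete (sym (proj₁ (tube-canonical j X))) | sameSubset-complete (sym (proj₂ (tube-canonical j X))) = dd
    go (capL X) _ = ∨-trueʳ (any≤ δ (λ j → isTube j (lowerOf (capL X)) (upperOf (capL X)))) _ (cong (_∨ isCapR (lowerOf (capL X)) (upperOf (capL X))) h)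
      where
      h : isCapL (lowerOf (capL X)) (upperOf (capL X)) ≡ true
      h rewrite sameSubset-complete (sym (proj₁ (capL-canonical X))) | sameSubset-complete (sym (proj₂ (capL-canonical X))) = refl
    go (capR X) _ = ∨-trueʳ (any≤ δ (λ j → isTube j (lowerOf (capR X)) (upperOf (capR X)))) _ (∨-trueʳ (isCapL (lowerOf (capR X)) (upperOf (capR X))) _ h)
      where
      h : isCapR (lowerOf (capR X)) (upperOf (capR X)) ≡ true
      h rewrite sameSubset-complete (sym (proj₁ (capR-canonical X))) | sameSubset-complete (sym (proj₂ (capR-canonical X))) = refl

  ∈P⇒facet : ∀ S → P S ≡ true → Σ Code λ D → Valid D × S ≡ facet D
  ∈P⇒facet S h with ∨-true {any≤ δ (λ j → isTube j (lowerPart S) (upperPart S))} h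
  ... | inj₁ h1 with any≤-sound δ _ h1
  ... | j , le , t with ∧-true {sameSubset (lowerPart S) _} t
  ... | a1 , r with ∧-true {sameSubset (upperPart S) _} r
  ... | a2 , a3 = tube j (upperPart S) , (le , cc (lookup (upperPart S) (ℓ j)) (lookup (upperPart S) (e j)) a3) ,
        trans (glue-parts S) (cong₂ glue (sameSubset-sound a1) (sameSubset-sound a2))
    where
    cc : ∀ x y → ⌊ x ≟B y ⌋ ≡ true → x ≡ y
    cc x y h with x ≟B y
    ... | yes q = q
  ∈P⇒facet S h | inj₂ h2 with ∨-true {isCapL (lowerPart S) (upperPart S)} h2
  ... | inj₁ h3 with ∧-true {sameSubset (lowerPart S) _} h3
  ... | a1 , a2 = capL (upperPart S) , tt , trans (glue-parts S) (cong₂ glue (sameSubset-sound a1) (sameSubset-sound a2))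
  ∈P⇒facet S h | inj₂ h2 | inj₂ h3 with ∧-true {sameSubset (lowerPart S) _} h3
  ... | a1 , a2 = capR (upperPart S) , tt , trans (glue-parts S) (cong₂ glue (sameSubset-sound a1) (sameSubset-sound a2))



module Ridges {n d : ℕ} (π : GeodesicPath n d) where
  open GeodesicPath π
  open Construction π
  open Doubling n

  tube-support : ∀ j X v → (lookup (lowerOf (tube j X)) v ∨ lookup (upperOf (tube j X)) v) ≡ lookup (F j) v
  tube-support j X v rewrite tube-lower j X v | tube-upper j X v = split-∨ (lookup (F j) v) (lookup X v)
  tube-disjoint : ∀ j X v → (lookup (lowerOf (tube j X)) v ∧ lookup (upperOf (tube j X)) v) ≡ false
  tube-disjoint j X v rewrite tube-lower j X v | tube-upper j X v = split-∧ (lookup (F j) v) (lookup X v)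
  tube-side : ∀ j X c v → sideAt c (lowerOf (tube j X)) (upperOf (tube j X)) v ≡ true → lookup (F j) v ≡ true × lookup X v ≡ c
  tube-side j X false v h rewrite tube-lower j X v = ∧not-true h
  tube-side j X true v h rewrite tube-upper j X v = ∧-true h
  tube-upper-bit : ∀ j X v → lookup (F j) v ≡ true → lookup (upperOf (tube j X)) v ≡ lookup X v
  tube-upper-bit j X v h rewrite tube-upper j X v | h = refl
  tube-side-of : ∀ j X v → lookup (F j) v ≡ true → sideAt (lookup X v) (lowerOf (tube j X)) (upperOf (tube j X)) v ≡ true
  tube-side-of j X v h with lookup X v in eq
  ... | false rewrite tube-lower j X v | h | eq = refl
  ... | true rewrite tube-upper j X v | h | eq = refl

  capL-apex : ∀ X → lookup (lowerOf (capL X)) wL ≡ true × lookup (upperOf (capL X)) wL ≡ true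
  capL-apex X rewrite capL-lower X wL | capL-upper X wL | eqb-refl wL = ∨-zeroʳ _ , ∨-zeroʳ _
  capL-support : ∀ X v → ¬ v ≡ wL → (lookup (lowerOf (capL X)) v ∨ lookup (upperOf (capL X)) v) ≡ lookup ZL v
  capL-support X v ne rewrite capL-lower X v | capL-upper X v | eqb-ne ne | ∨-identityʳ (lookup ZL v ∧ not (lookup X v)) | ∨-identityʳ (lookup ZL v ∧ lookup X v)
    = split-∨ (lookup ZL v) (lookup X v)
  capL-disjoint : ∀ X v → ¬ v ≡ wL → (lookup (lowerOf (capL X)) v ∧ lookup (upperOf (capL X)) v) ≡ false
  capL-disjoint X v ne rewrite capL-lower X v | capL-upper X v | eqb-ne ne | ∨-identityʳ (lookup ZL v ∧ not (lookup X v)) | ∨-identityʳ (lookup ZL v ∧ lookup X v)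
    = split-∧ (lookup ZL v) (lookup X v)
  capL-side : ∀ X c v → ¬ v ≡ wL → sideAt c (lowerOf (capL X)) (upperOf (capL X)) v ≡ true → lookup ZL v ≡ true × lookup X v ≡ c
  capL-side X false v ne h rewrite capL-lower X v | eqb-ne ne | ∨-identityʳ (lookup ZL v ∧ not (lookup X v)) = ∧not-true h
  capL-side X true v ne h rewrite capL-upper X v | eqb-ne ne | ∨-identityʳ (lookup ZL v ∧ lookup X v) = ∧-true h

  capR-apex : ∀ X → lookup (lowerOf (capR X)) wR ≡ true × lookup (upperOf (capR X)) wR ≡ true
  capR-apex X rewrite capR-lower X wR | capR-upper X wR | eqb-refl wR = ∨-zeroʳ _ , ∨-zeroʳ _
  capR-support : ∀ X v → ¬ v ≡ wR → (lookup (lowerOf (capR X)) v ∨ lookup (upperOf (capR X)) v) ≡ lookup ZR v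
  capR-support X v ne rewrite capR-lower X v | capR-upper X v | eqb-ne ne | ∨-identityʳ (lookup ZR v ∧ not (lookup X v)) | ∨-identityʳ (lookup ZR v ∧ lookup X v)
    = split-∨ (lookup ZR v) (lookup X v)
  capR-disjoint : ∀ X v → ¬ v ≡ wR → (lookup (lowerOf (capR X)) v ∧ lookup (upperOf (capR X)) v) ≡ false
  capR-disjoint X v ne rewrite capR-lower X v | capR-upper X v | eqb-ne ne | ∨-identityʳ (lookup ZR v ∧ not (lookup X v)) | ∨-identityʳ (lookup ZR v ∧ lookup X v)
    = split-∧ (lookup ZR v) (lookup X v)
  capR-side : ∀ X c v → ¬ v ≡ wR → sideAt c (lowerOf (capR X)) (upperOf (capR X)) v ≡ true → lookup ZR v ≡ true × lookup X v ≡ c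
  capR-side X false v ne h rewrite capR-lower X v | eqb-ne ne | ∨-identityʳ (lookup ZR v ∧ not (lookup X v)) = ∧not-true h
  capR-side X true v ne h rewrite capR-upper X v | eqb-ne ne | ∨-identityʳ (lookup ZR v ∧ lookup X v) = ∧-true h

  facet-pure : ∀ D → Valid D → ∣ facet D ∣ ≡ d
  facet-pure (tube j X) (j≤δ , _) = begin
    ∣ facet (tube j X) ∣                            ≡⟨ card-glue (lowerOf (tube j X)) (upperOf (tube j X)) ⟩
    ∣ lowerOf (tube j X) ∣ + ∣ upperOf (tube j X) ∣ ≡⟨ card-disjoint-union (F j) (lowerOf (tube j X)) (upperOf (tube j X)) (λ v → sym (tube-support j X v)) (tube-disjoint j X) ⟩
    ∣ F j ∣                                         ≡⟨ ∣F∣≡d j j≤δ ⟩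
    d                                               ∎
    where open ≡-Reasoning
  facet-pure (capL X) _ = begin
    ∣ facet (capL X) ∣                          ≡⟨ card-glue (lowerOf (capL X)) (upperOf (capL X)) ⟩
    ∣ lowerOf (capL X) ∣ + ∣ upperOf (capL X) ∣ ≡⟨ card-with-apex ZL (lowerOf (capL X)) (upperOf (capL X)) wL (proj₁ (capL-apex X)) (proj₂ (capL-apex X)) wL∉ZL
                                                     (λ v v≢w → sym (capL-support X v v≢w)) (capL-disjoint X) ⟩
    suc (suc ∣ ZL ∣)                            ≡⟨ sym card-ZL ⟩
    ∣ F 0 ∣                                     ≡⟨ ∣F∣≡d 0 z≤n ⟩
    d                                           ∎
    where open ≡-Reasoning
  facet-pure (capR X) _ = begin
    ∣ facet (capR X) ∣                          ≡⟨ card-glue (lowerOf (capR X)) (upperOf (capR X)) ⟩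
    ∣ lowerOf (capR X) ∣ + ∣ upperOf (capR X) ∣ ≡⟨ card-with-apex ZR (lowerOf (capR X)) (upperOf (capR X)) wR (proj₁ (capR-apex X)) (proj₂ (capR-apex X)) wR∉ZR
                                                     (λ v v≢w → sym (capR-support X v v≢w)) (capR-disjoint X) ⟩
    suc (suc ∣ ZR ∣)                            ≡⟨ sym card-ZR ⟩
    ∣ F δ ∣                                     ≡⟨ ∣F∣≡d δ ≤-refl ⟩
    d                                           ∎
    where open ≡-Reasoning

  tube-support-agree : ∀ i X j Y v → SameAt (lowerOf (tube i X)) (upperOf (tube i X)) (lowerOf (tube j Y)) (upperOf (tube j Y)) v → lookup (F i) v ≡ lookup (F j) v
  tube-support-agree i X j Y v (p1 , p2) = trans (sym (tube-support i X v)) (trans (cong₂ _∨_ p1 p2) (tube-support j Y v))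
  tube-bit-agree : ∀ i X j Y v → SameAt (lowerOf (tube i X)) (upperOf (tube i X)) (lowerOf (tube j Y)) (upperOf (tube j Y)) v → lookup (F i) v ≡ true → lookup X v ≡ lookup Y v
  tube-bit-agree i X j Y v pe h = trans (sym (tube-upper-bit i X v h)) (trans (proj₂ pe) (tube-upper-bit j Y v (trans (sym (tube-support-agree i X j Y v pe)) h)))

  tube-tube-same-vertex : ∀ {RA RB : Subset n} i X j Y u c c'' → Valid (tube i X) → Valid (tube j Y) →
    Extends RA RB (lowerOf (tube i X)) (upperOf (tube i X)) u c → Extends RA RB (lowerOf (tube j Y)) (upperOf (tube j Y)) u c'' →
    ¬ c'' ≡ c → j ≡ i × c'' ≡ not c × ¬ u ≡ ℓ i × ¬ u ≡ e i
  tube-tube-same-vertex {RA} {RB} i X j Y u c c'' (iδ , vX) (jδ , vY) hK hH c≢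
    with tube-side i X c u (Extends.added hK) | tube-side j Y c'' u (Extends.added hH)
  ... | fu , xu | gu , yu = ij , ¬-not c≢ , u≢ℓ , u≢e
    where
    FF : F i ≡ F j
    FF = lookup-ext (F i) (F j) f
      where
      f : ∀ v → lookup (F i) v ≡ lookup (F j) v
      f v with v ≟F u
      ... | yes refl = trans fu (sym gu)
      ... | no v≢u = tube-support-agree i X j Y v (Extends-agree hK hH v v≢u v≢u)
    ij : j ≡ i
    ij = sym (F-injective i j iδ jδ FF)
    bits : ∀ v → ¬ v ≡ u → lookup (F i) v ≡ true → lookup X v ≡ lookup Y v
    bits v v≢u h = tube-bit-agree i X j Y v (Extends-agree hK hH v v≢u v≢u) h
    u≢ℓ : ¬ u ≡ ℓ i
    u≢ℓ eq = c≢ (sym (begin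
        c ≡⟨ sym xu ⟩ lookup X u ≡⟨ cong (lookup X) eq ⟩ lookup X (ℓ i) ≡⟨ vX ⟩ lookup X (e i)
          ≡⟨ bits (e i) (λ q → e≢ℓ i iδ (trans q eq)) (e∈ i iδ) ⟩ lookup Y (e i)
          ≡⟨ cong (λ k → lookup Y (e k)) (sym ij) ⟩ lookup Y (e j) ≡⟨ sym vY ⟩ lookup Y (ℓ j)
          ≡⟨ cong (λ k → lookup Y (ℓ k)) ij ⟩ lookup Y (ℓ i) ≡⟨ cong (lookup Y) (sym eq) ⟩ lookup Y u ≡⟨ yu ⟩ c'' ∎))
      where open ≡-Reasoning
    u≢e : ¬ u ≡ e i
    u≢e eq = c≢ (sym (begin
        c ≡⟨ sym xu ⟩ lookup X u ≡⟨ cong (lookup X) eq ⟩ lookup X (e i) ≡⟨ sym vX ⟩ lookup X (ℓ i)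
          ≡⟨ bits (ℓ i) (λ q → e≢ℓ i iδ (trans (sym eq) (sym q))) (ℓ∈ i iδ) ⟩ lookup Y (ℓ i)
          ≡⟨ cong (λ k → lookup Y (ℓ k)) (sym ij) ⟩ lookup Y (ℓ j) ≡⟨ vY ⟩ lookup Y (e j)
          ≡⟨ cong (λ k → lookup Y (e k)) ij ⟩ lookup Y (e i) ≡⟨ cong (lookup Y) (sym eq) ⟩ lookup Y u ≡⟨ yu ⟩ c'' ∎))
      where open ≡-Reasoning

  tube-tube-other-vertex : ∀ {RA RB : Subset n} i X j Y u c u'' c'' → Valid (tube i X) → Valid (tube j Y) →
    Extends RA RB (lowerOf (tube i X)) (upperOf (tube i X)) u c → Extends RA RB (lowerOf (tube j Y)) (upperOf (tube j Y)) u'' c'' →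
    ¬ u'' ≡ u →
    (j ≡ suc i × u ≡ ℓ i × u'' ≡ e j × c'' ≡ lookup X (ℓ j)) ⊎
    (i ≡ suc j × u ≡ e i × u'' ≡ ℓ j × c'' ≡ lookup X (e j))
  tube-tube-other-vertex {RA} {RB} i X j Y u c u'' c'' (iδ , vX) (jδ , vY) hK hH ne
    with tube-side i X c u (Extends.added hK) | tube-side j Y c'' u'' (Extends.added hH)
  ... | fu , xu | gu , yu = res (consecutive i j (geodesic i j iδ jδ U cU Ui Uj) (geodesic j i jδ iδ U cU Uj Ui) i≢j)
    where
    Fju : lookup (F j) u ≡ false
    Fju = trans (sym (tube-support j Y u)) (trans (cong₂ _∨_ (proj₁ (Extends-elsewhere hH (λ q → ne (sym q)))) (proj₂ (Extends-elsewhere hH (λ q → ne (sym q)))))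
            (∨-false RA RB u (Extends-absent hK (tube-disjoint i X u))))
    Fiu'' : lookup (F i) u'' ≡ false
    Fiu'' = trans (sym (tube-support i X u'')) (trans (cong₂ _∨_ (proj₁ (Extends-elsewhere hK ne)) (proj₂ (Extends-elsewhere hK ne)))
            (∨-false RA RB u'' (Extends-absent hH (tube-disjoint j Y u''))))
    U = remove (F i) u
    cU : suc ∣ U ∣ ≡ d
    cU = trans (sym (card-remove (F i) u fu)) (∣F∣≡d i iδ)
    Uv : ∀ v → lookup U v ≡ true → lookup (F i) v ≡ true × ¬ v ≡ u
    Uv v h = remove⁻ (F i) u v h
    Ui : U ⊑ F i
    Ui v h = proj₁ (Uv v h)
    same : ∀ v → lookup (F i) v ≡ true → ¬ v ≡ u → lookup (F i) v ≡ lookup (F j) v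
    same v h q = tube-support-agree i X j Y v (Extends-agree hK hH v q (λ r → bit-clash h (subst (λ t → lookup (F i) t ≡ false) (sym r) Fiu'')))
    Uj : U ⊑ F j
    Uj v h with Uv v h
    ... | a , b = trans (sym (same v a b)) a
    i≢j : ¬ i ≡ j
    i≢j refl = bit-clash fu Fju
    sameG : ∀ v → ¬ v ≡ u → ¬ v ≡ u'' → lookup (F i) v ≡ lookup (F j) v
    sameG v q r = tube-support-agree i X j Y v (Extends-agree hK hH v q r)
    bitG : ∀ v → ¬ v ≡ u → ¬ v ≡ u'' → lookup (F j) v ≡ true → lookup X v ≡ lookup Y v
    bitG v q r h = tube-bit-agree i X j Y v (Extends-agree hK hH v q r) (trans (sameG v q r) h)
    res : j ≡ suc i ⊎ i ≡ suc j → _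
    res (inj₁ refl) = inj₁ (refl , uℓ , ue , cc)
      where
      iδ' : i < δ
      iδ' = jδ
      uℓ : u ≡ ℓ i
      uℓ with u ≟F ℓ i
      ... | yes q = q
      ... | no q = ⊥-elim (bit-clash (trans (sym (same (ℓ i) (ℓ∈ i iδ) (λ r → q (sym r)))) (ℓ∈ i iδ)) (ℓ∉ i iδ'))
      ue : u'' ≡ e (suc i)
      ue with u'' ≟F e (suc i)
      ... | yes q = q
      ... | no q = ⊥-elim (bit-clash (trans (sameG (e (suc i)) (≢-by-membership (F j) (e∈ (suc i) jδ) Fju) (λ r → q (sym r))) (e∈ (suc i) jδ)) (e∉ i iδ'))
      cc : c'' ≡ lookup X (ℓ (suc i))
      cc = trans (sym yu) (trans (cong (lookup Y) ue) (trans (sym vY)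
             (sym (bitG (ℓ (suc i)) (≢-by-membership (F j) (ℓ∈ (suc i) jδ) Fju) (λ r → e≢ℓ (suc i) jδ (trans (sym ue) (sym r))) (ℓ∈ (suc i) jδ)))))
    res (inj₂ refl) = inj₂ (refl , ue , uℓ , cc)
      where
      ue : u ≡ e (suc j)
      ue with u ≟F e (suc j)
      ... | yes q = q
      ... | no q = ⊥-elim (bit-clash (trans (sym (sameG (e (suc j)) (λ r → q (sym r)) (≢-by-membership (F i) (e∈ (suc j) iδ) Fiu''))) (e∈ (suc j) iδ)) (e∉ j iδ))
      uℓ : u'' ≡ ℓ j
      uℓ with u'' ≟F ℓ j
      ... | yes q = q
      ... | no q = ⊥-elim (bit-clash (trans (sameG (ℓ j) (≢-by-membership (F j) (ℓ∈ j jδ) Fju) (λ r → q (sym r))) (ℓ∈ j jδ)) (ℓ∉ j iδ))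
      cc : c'' ≡ lookup X (e j)
      cc = trans (sym yu) (trans (cong (lookup Y) uℓ) (trans vY
             (sym (bitG (e j) (≢-by-membership (F j) (e∈ j jδ) Fju) (λ r → e≢ℓ j jδ (trans r uℓ)) (e∈ j jδ)))))

  tube-tube-rivals : ∀ {RA RB : Subset n} i X j Y u c u'' c'' → Valid (tube i X) → Valid (tube j Y) →
    Extends RA RB (lowerOf (tube i X)) (upperOf (tube i X)) u c → Extends RA RB (lowerOf (tube j Y)) (upperOf (tube j Y)) u'' c'' →
    ¬ (u'' ≡ u × c'' ≡ c) →
    (j ≡ i × u'' ≡ u × c'' ≡ not c × ¬ u ≡ ℓ i × ¬ u ≡ e i) ⊎
    (j ≡ suc i × u ≡ ℓ i × u'' ≡ e j × c'' ≡ lookup X (ℓ j)) ⊎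
    (i ≡ suc j × u ≡ e i × u'' ≡ ℓ j × c'' ≡ lookup X (e j))
  tube-tube-rivals i X j Y u c u'' c'' vi vj hK hH dist with u'' ≟F u
  ... | yes refl with tube-tube-same-vertex i X j Y u c c'' vi vj hK hH (λ e → dist (refl , e))
  ...   | ji , c''≡ , nℓ , ne = inj₁ (ji , refl , c''≡ , nℓ , ne)
  tube-tube-rivals i X j Y u c u'' c'' vi vj hK hH dist | no ne = inj₂ (tube-tube-other-vertex i X j Y u c u'' c'' vi vj hK hH ne)

  e0∉ZL : lookup ZL (e 0) ≡ false
  e0∉ZL with lookup ZL (e 0) in eq
  ... | true = ⊥-elim (proj₁ (proj₂ (ZL⁻ (e 0) eq)) refl)
  ... | false = refl
  ℓδ∉ZR : lookup ZR (ℓ δ) ≡ false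
  ℓδ∉ZR with lookup ZR (ℓ δ) in eq
  ... | true = ⊥-elim (proj₁ (proj₂ (ZR⁻ (ℓ δ) eq)) refl)
  ... | false = refl

  tube-capL-rivals : ∀ {RA RB : Subset n} i X Y u c u'' c'' → Valid (tube i X) →
    Extends RA RB (lowerOf (tube i X)) (upperOf (tube i X)) u c → Extends RA RB (lowerOf (capL Y)) (upperOf (capL Y)) u'' c'' →
    ¬ (u'' ≡ u × c'' ≡ c) →
    i ≡ 0 × u ≡ e 0 × u'' ≡ wL × c'' ≡ not (lookup X wL)
  tube-capL-rivals {RA} {RB} i X Y u c u'' c'' (iδ , vX) hK hH dist with u'' ≟F wL
  ... | no q = ⊥-elim (disjoint-clash {A = lowerOf (tube i X)} {B = upperOf (tube i X)} {v = wL}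
          (proj₁ (Extends⇒⊑ hK) wL (trans (sym (proj₁ (Extends.agree hH wL (λ r → q (sym r))))) (proj₁ (capL-apex Y))))
          (proj₂ (Extends⇒⊑ hK) wL (trans (sym (proj₂ (Extends.agree hH wL (λ r → q (sym r))))) (proj₂ (capL-apex Y))))
          (tube-disjoint i X wL))
  ... | yes refl = i0 , ue , refl , cc
    where
    fu = proj₁ (tube-side i X c u (Extends.added hK))
    Rs : sideAt (not c'') RA RB wL ≡ true × sideAt c'' RA RB wL ≡ false
    Rs = Extends-double hH (proj₁ (capL-apex Y)) (proj₂ (capL-apex Y))
    u≢ : ¬ u ≡ wL
    u≢ refl = dist (refl , trans (sym (not-involutive c'')) (sym (opposite-sides (not c'') c RA RB wL (proj₁ Rs) (Extends.absent hK))))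
    KwL : lookup (lowerOf (tube i X)) wL ≡ lookup RA wL × lookup (upperOf (tube i X)) wL ≡ lookup RB wL
    KwL = Extends.agree hK wL (λ r → u≢ (sym r))
    FwL : lookup (F i) wL ≡ true
    FwL = trans (sym (tube-support i X wL)) (trans (support-agree (lowerOf (tube i X)) (upperOf (tube i X)) RA RB wL KwL) (sideAt⇒∨ (not c'') RA RB wL (proj₁ Rs)))
    Zu : lookup ZL u ≡ false
    Zu = trans (sym (capL-support Y u u≢)) (trans (support-agree (lowerOf (capL Y)) (upperOf (capL Y)) RA RB u (Extends-elsewhere hH u≢)) (∨-false RA RB u (Extends-absent hK (tube-disjoint i X u))))
    sameZ : ∀ v → ¬ v ≡ u → ¬ v ≡ wL → lookup (F i) v ≡ lookup ZL v
    sameZ v q r = trans (sym (tube-support i X v)) (trans (support-agree (lowerOf (tube i X)) (upperOf (tube i X)) (lowerOf (capL Y)) (upperOf (capL Y)) v (Extends-agree hK hH v q r)) (capL-support Y v r))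
    U = remove (F 0) (e 0)
    Uv : ∀ v → lookup U v ≡ true → lookup (F 0) v ≡ true × ¬ v ≡ e 0
    Uv v h = remove⁻ (F 0) (e 0) v h
    Ui : U ⊑ F i
    Ui v h with Uv v h | v ≟F wL
    ... | _ | yes refl = FwL
    ... | a , b | no r = trans (sameZ v (λ s → bit-clash (ZL⁺ v a b r) (subst (λ t → lookup ZL t ≡ false) (sym s) Zu)) r) (ZL⁺ v a b r)
    cU : suc ∣ U ∣ ≡ d
    cU = trans (sym (card-remove (F 0) (e 0) (e∈ 0 z≤n))) (∣F∣≡d 0 z≤n)
    i≤1 : i ≤ 1
    i≤1 = geodesic 0 i z≤n iδ U cU (λ v h → proj₁ (Uv v h)) Ui
    ℓ0U : lookup U (ℓ 0) ≡ true
    ℓ0U = trans (remove-other (F 0) (λ r → e≢ℓ 0 z≤n (sym r))) (ℓ∈ 0 z≤n)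
    i0 : i ≡ 0
    i0 = ≤1∧≢1⇒≡0 i i≤1 (λ eq → bit-clash (subst (λ k → lookup (F k) (ℓ 0) ≡ true) eq (Ui (ℓ 0) ℓ0U)) (ℓ∉ 0 (subst (_≤ δ) eq iδ)))
    ue : u ≡ e 0
    ue with u ≟F e 0
    ... | yes q = q
    ... | no q = ⊥-elim (bit-clash (subst (λ k → lookup (F k) (e 0) ≡ true) (sym i0) (e∈ 0 z≤n))
                   (trans (sameZ (e 0) (λ r → q (sym r)) (λ r → wL≢e (sym r))) e0∉ZL))
    cc : c'' ≡ not (lookup X wL)
    cc = opposite-sides (lookup X wL) c'' RA RB wL
           (trans (sym (sd (lookup X wL))) (tube-side-of i X wL FwL)) (proj₂ Rs)
      where
      sd : ∀ b → sideAt b (lowerOf (tube i X)) (upperOf (tube i X)) wL ≡ sideAt b RA RB wL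
      sd false = proj₁ KwL
      sd true = proj₂ KwL

  tube-capR-rivals : ∀ {RA RB : Subset n} i X Y u c u'' c'' → Valid (tube i X) →
    Extends RA RB (lowerOf (tube i X)) (upperOf (tube i X)) u c → Extends RA RB (lowerOf (capR Y)) (upperOf (capR Y)) u'' c'' →
    ¬ (u'' ≡ u × c'' ≡ c) →
    i ≡ δ × u ≡ ℓ δ × u'' ≡ wR × c'' ≡ not (lookup X wR)
  tube-capR-rivals {RA} {RB} i X Y u c u'' c'' (iδ , vX) hK hH dist with u'' ≟F wR
  ... | no q = ⊥-elim (disjoint-clash {A = lowerOf (tube i X)} {B = upperOf (tube i X)} {v = wR}
          (proj₁ (Extends⇒⊑ hK) wR (trans (sym (proj₁ (Extends.agree hH wR (λ r → q (sym r))))) (proj₁ (capR-apex Y))))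
          (proj₂ (Extends⇒⊑ hK) wR (trans (sym (proj₂ (Extends.agree hH wR (λ r → q (sym r))))) (proj₂ (capR-apex Y))))
          (tube-disjoint i X wR))
  ... | yes refl = iD , uℓ , refl , cc
    where
    Rs : sideAt (not c'') RA RB wR ≡ true × sideAt c'' RA RB wR ≡ false
    Rs = Extends-double hH (proj₁ (capR-apex Y)) (proj₂ (capR-apex Y))
    u≢ : ¬ u ≡ wR
    u≢ refl = dist (refl , trans (sym (not-involutive c'')) (sym (opposite-sides (not c'') c RA RB wR (proj₁ Rs) (Extends.absent hK))))
    KwR : lookup (lowerOf (tube i X)) wR ≡ lookup RA wR × lookup (upperOf (tube i X)) wR ≡ lookup RB wR
    KwR = Extends.agree hK wR (λ r → u≢ (sym r))
    FwR : lookup (F i) wR ≡ true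
    FwR = trans (sym (tube-support i X wR)) (trans (support-agree (lowerOf (tube i X)) (upperOf (tube i X)) RA RB wR KwR) (sideAt⇒∨ (not c'') RA RB wR (proj₁ Rs)))
    Zu : lookup ZR u ≡ false
    Zu = trans (sym (capR-support Y u u≢)) (trans (support-agree (lowerOf (capR Y)) (upperOf (capR Y)) RA RB u (Extends-elsewhere hH u≢)) (∨-false RA RB u (Extends-absent hK (tube-disjoint i X u))))
    sameZ : ∀ v → ¬ v ≡ u → ¬ v ≡ wR → lookup (F i) v ≡ lookup ZR v
    sameZ v q r = trans (sym (tube-support i X v)) (trans (support-agree (lowerOf (tube i X)) (upperOf (tube i X)) (lowerOf (capR Y)) (upperOf (capR Y)) v (Extends-agree hK hH v q r)) (capR-support Y v r))
    U = remove (F δ) (ℓ δ)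
    Uv : ∀ v → lookup U v ≡ true → lookup (F δ) v ≡ true × ¬ v ≡ ℓ δ
    Uv v h = remove⁻ (F δ) (ℓ δ) v h
    Ui : U ⊑ F i
    Ui v h with Uv v h | v ≟F wR
    ... | _ | yes refl = FwR
    ... | a , b | no r = trans (sameZ v (λ s → bit-clash (ZR⁺ v a b r) (subst (λ t → lookup ZR t ≡ false) (sym s) Zu)) r) (ZR⁺ v a b r)
    cU : suc ∣ U ∣ ≡ d
    cU = trans (sym (card-remove (F δ) (ℓ δ) (ℓ∈ δ ≤-refl))) (∣F∣≡d δ ≤-refl)
    δ≤ : δ ≤ suc i
    δ≤ = geodesic i δ iδ ≤-refl U cU Ui (λ v h → proj₁ (Uv v h))
    eδU : lookup U (e δ) ≡ true
    eδU = trans (remove-other (F δ) (e≢ℓ δ ≤-refl)) (e∈ δ ≤-refl)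
    iD : i ≡ δ
    iD = ≤-suc-≢⇒≡ i δ iδ δ≤ (λ eq → bit-clash (Ui (e δ) eδU) (subst (λ k → lookup (F i) (e k) ≡ false) eq (e∉ i (subst (suc i ≤_) eq ≤-refl))))
    uℓ : u ≡ ℓ δ
    uℓ with u ≟F ℓ δ
    ... | yes q = q
    ... | no q = ⊥-elim (bit-clash (subst (λ k → lookup (F k) (ℓ δ) ≡ true) (sym iD) (ℓ∈ δ ≤-refl))
                   (trans (sameZ (ℓ δ) (λ r → q (sym r)) (λ r → wR≢ℓ (sym r))) ℓδ∉ZR))
    cc : c'' ≡ not (lookup X wR)
    cc = opposite-sides (lookup X wR) c'' RA RB wR
           (trans (sym (sd (lookup X wR))) (tube-side-of i X wR FwR)) (proj₂ Rs)
      where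
      sd : ∀ b → sideAt b (lowerOf (tube i X)) (upperOf (tube i X)) wR ≡ sideAt b RA RB wR
      sd false = proj₁ KwR
      sd true = proj₂ KwR

  capL-capL-rivals : ∀ {RA RB : Subset n} X Y u c u'' c'' →
    Extends RA RB (lowerOf (capL X)) (upperOf (capL X)) u c → Extends RA RB (lowerOf (capL Y)) (upperOf (capL Y)) u'' c'' →
    ¬ (u'' ≡ u × c'' ≡ c) →
    u'' ≡ u × c'' ≡ not c × ¬ u ≡ wL
  capL-capL-rivals {RA} {RB} X Y u c u'' c'' hK hH dist with u ≟F wL
  ... | yes refl = ⊥-elim (LLw u'' c'' hH dist)
    where
    Rs = Extends-double hK (proj₁ (capL-apex X)) (proj₂ (capL-apex X))
    LLw : ∀ u'' c'' → Extends RA RB (lowerOf (capL Y)) (upperOf (capL Y)) u'' c'' → ¬ (u'' ≡ wL × c'' ≡ c) → ⊥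
    LLw u'' c'' hH dist with u'' ≟F wL
    ... | yes refl = dist (refl , trans (opposite-sides (not c) c'' RA RB wL (proj₁ Rs) (Extends.absent hH)) (not-involutive c))
    ... | no q = bit-clash (sideAt-double (lowerOf (capL Y)) (upperOf (capL Y)) wL (proj₁ (capL-apex Y)) (proj₂ (capL-apex Y)) c)
                   (trans (sideAt-agree (lowerOf (capL Y)) (upperOf (capL Y)) RA RB wL (Extends.agree hH wL (λ r → q (sym r))) c) (proj₂ Rs))
  ... | no q with u'' ≟F u
  ... | yes refl = refl , ¬-not (λ e → dist (refl , e)) , q
  ... | no q' = ⊥-elim (bit-clash (proj₁ (capL-side X c u q (Extends.added hK)))
                  (trans (sym (capL-support Y u q)) (trans (support-agree (lowerOf (capL Y)) (upperOf (capL Y)) RA RB u (Extends-elsewhere hH (λ r → q' (sym r))))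
                    (∨-false RA RB u (Extends-absent hK (capL-disjoint X u q))))))

  capR-capR-rivals : ∀ {RA RB : Subset n} X Y u c u'' c'' →
    Extends RA RB (lowerOf (capR X)) (upperOf (capR X)) u c → Extends RA RB (lowerOf (capR Y)) (upperOf (capR Y)) u'' c'' →
    ¬ (u'' ≡ u × c'' ≡ c) →
    u'' ≡ u × c'' ≡ not c × ¬ u ≡ wR
  capR-capR-rivals {RA} {RB} X Y u c u'' c'' hK hH dist with u ≟F wR
  ... | yes refl = ⊥-elim (RRw u'' c'' hH dist)
    where
    Rs = Extends-double hK (proj₁ (capR-apex X)) (proj₂ (capR-apex X))
    RRw : ∀ u'' c'' → Extends RA RB (lowerOf (capR Y)) (upperOf (capR Y)) u'' c'' → ¬ (u'' ≡ wR × c'' ≡ c) → ⊥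
    RRw u'' c'' hH dist with u'' ≟F wR
    ... | yes refl = dist (refl , trans (opposite-sides (not c) c'' RA RB wR (proj₁ Rs) (Extends.absent hH)) (not-involutive c))
    ... | no q = bit-clash (sideAt-double (lowerOf (capR Y)) (upperOf (capR Y)) wR (proj₁ (capR-apex Y)) (proj₂ (capR-apex Y)) c)
                   (trans (sideAt-agree (lowerOf (capR Y)) (upperOf (capR Y)) RA RB wR (Extends.agree hH wR (λ r → q (sym r))) c) (proj₂ Rs))
  ... | no q with u'' ≟F u
  ... | yes refl = refl , ¬-not (λ e → dist (refl , e)) , q
  ... | no q' = ⊥-elim (bit-clash (proj₁ (capR-side X c u q (Extends.added hK)))
                  (trans (sym (capR-support Y u q)) (trans (support-agree (lowerOf (capR Y)) (upperOf (capR Y)) RA RB u (Extends-elsewhere hH (λ r → q' (sym r))))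
                    (∨-false RA RB u (Extends-absent hK (capR-disjoint X u q))))))

  capL-capR-disjoint : ∀ {RA RB : Subset n} X Y u c u'' c'' →
    Extends RA RB (lowerOf (capL X)) (upperOf (capL X)) u c → Extends RA RB (lowerOf (capR Y)) (upperOf (capR Y)) u'' c'' → ⊥
  capL-capR-disjoint {RA} {RB} X Y u c u'' c'' hK hH with u ≟F wL | u'' ≟F wR
  ... | no q | _ = disjoint-clash {A = lowerOf (capR Y)} {B = upperOf (capR Y)} {v = wL}
          (proj₁ (Extends⇒⊑ hH) wL (trans (sym (proj₁ (Extends.agree hK wL (λ r → q (sym r))))) (proj₁ (capL-apex X))))
          (proj₂ (Extends⇒⊑ hH) wL (trans (sym (proj₂ (Extends.agree hK wL (λ r → q (sym r))))) (proj₂ (capL-apex X))))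
          (capR-disjoint Y wL wL≢wR)
  ... | yes refl | no q = disjoint-clash {A = lowerOf (capL X)} {B = upperOf (capL X)} {v = wR}
          (proj₁ (Extends⇒⊑ hK) wR (trans (sym (proj₁ (Extends.agree hH wR (λ r → q (sym r))))) (proj₁ (capR-apex Y))))
          (proj₂ (Extends⇒⊑ hK) wR (trans (sym (proj₂ (Extends.agree hH wR (λ r → q (sym r))))) (proj₂ (capR-apex Y))))
          (capL-disjoint X wR (λ r → wL≢wR (sym r)))
  ... | yes refl | yes refl = δcase (≤1∧≢1⇒≡0 δ δ≤1 δ≢1)
    where
    RsL = Extends-double hK (proj₁ (capL-apex X)) (proj₂ (capL-apex X))
    RsR = Extends-double hH (proj₁ (capR-apex Y)) (proj₂ (capR-apex Y))
    ZRwL : lookup ZR wL ≡ true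
    ZRwL = trans (sym (capR-support Y wL wL≢wR)) (trans (support-agree (lowerOf (capR Y)) (upperOf (capR Y)) RA RB wL (Extends.agree hH wL wL≢wR))
             (sideAt⇒∨ (not c) RA RB wL (proj₁ RsL)))
    sameZ : ∀ v → ¬ v ≡ wL → ¬ v ≡ wR → lookup ZL v ≡ lookup ZR v
    sameZ v q r = trans (sym (capL-support X v q)) (trans (support-agree (lowerOf (capL X)) (upperOf (capL X)) (lowerOf (capR Y)) (upperOf (capR Y)) v (Extends-agree hK hH v q r)) (capR-support Y v r))
    U = remove (F 0) (e 0)
    Uv : ∀ v → lookup U v ≡ true → lookup (F 0) v ≡ true × ¬ v ≡ e 0
    Uv v h = remove⁻ (F 0) (e 0) v h
    UZ : ∀ v → lookup U v ≡ true → ¬ v ≡ wR → lookup ZR v ≡ true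
    UZ v h r with v ≟F wL | Uv v h
    ... | yes refl | _ = ZRwL
    ... | no q | a , b = trans (sym (sameZ v q r)) (ZL⁺ v a b q)
    Uδ : U ⊑ F δ
    Uδ v h with v ≟F wR
    ... | yes refl = wR∈
    ... | no r = proj₁ (ZR⁻ v (UZ v h r))
    cU : suc ∣ U ∣ ≡ d
    cU = trans (sym (card-remove (F 0) (e 0) (e∈ 0 z≤n))) (∣F∣≡d 0 z≤n)
    δ≤1 : δ ≤ 1
    δ≤1 = geodesic 0 δ z≤n ≤-refl U cU (λ v h → proj₁ (Uv v h)) Uδ
    ℓ0U : lookup U (ℓ 0) ≡ true
    ℓ0U = trans (remove-other (F 0) (λ r → e≢ℓ 0 z≤n (sym r))) (ℓ∈ 0 z≤n)
    δ≢1 : ¬ δ ≡ 1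
    δ≢1 eq = bit-clash (Uδ (ℓ 0) ℓ0U) (subst (λ k → lookup (F k) (ℓ 0) ≡ false) (sym eq) (ℓ∉ 0 (subst (1 ≤_) (sym eq) ≤-refl)))
    δcase : δ ≡ 0 → ⊥
    δcase eq = proj₁ (proj₂ (ZR⁻ (ℓ 0) (UZ (ℓ 0) ℓ0U (λ r → wR≢ℓ (trans (sym r) (cong ℓ (sym eq))))))) (cong ℓ (sym eq))

  tube-tube-agree : ∀ i X j Y v → lookup (F i) v ≡ lookup (F j) v → (lookup (F i) v ≡ true → lookup X v ≡ lookup Y v) →
         lookup (lowerOf (tube i X)) v ≡ lookup (lowerOf (tube j Y)) v × lookup (upperOf (tube i X)) v ≡ lookup (upperOf (tube j Y)) v
  tube-tube-agree i X j Y v ff bb rewrite tube-lower i X v | tube-upper i X v | tube-lower j Y v | tube-upper j Y v with lookup (F i) v | lookup (F j) v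
  ... | false | false = refl , refl
  ... | true | true rewrite bb refl = refl , refl
  ... | true | false = ⊥-elim (true≢false ff)
  ... | false | true = ⊥-elim (true≢false (sym ff))

  capL-capL-agree : ∀ X Y v → (lookup ZL v ≡ true → lookup X v ≡ lookup Y v) →
         lookup (lowerOf (capL X)) v ≡ lookup (lowerOf (capL Y)) v × lookup (upperOf (capL X)) v ≡ lookup (upperOf (capL Y)) v
  capL-capL-agree X Y v bb rewrite capL-lower X v | capL-upper X v | capL-lower Y v | capL-upper Y v with lookup ZL v
  ... | false = refl , refl
  ... | true rewrite bb refl = refl , refl
  capR-capR-agree : ∀ X Y v → (lookup ZR v ≡ true → lookup X v ≡ lookup Y v) →
         lookup (lowerOf (capR X)) v ≡ lookup (lowerOf (capR Y)) v × lookup (upperOf (capR X)) v ≡ lookup (upperOf (capR Y)) v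
  capR-capR-agree X Y v bb rewrite capR-lower X v | capR-upper X v | capR-lower Y v | capR-upper Y v with lookup ZR v
  ... | false = refl , refl
  ... | true rewrite bb refl = refl , refl

  tube-capL-agree : ∀ i X Y v → ¬ v ≡ wL → lookup (F i) v ≡ lookup ZL v → (lookup ZL v ≡ true → lookup X v ≡ lookup Y v) →
         lookup (lowerOf (tube i X)) v ≡ lookup (lowerOf (capL Y)) v × lookup (upperOf (tube i X)) v ≡ lookup (upperOf (capL Y)) v
  tube-capL-agree i X Y v ne ff bb rewrite tube-lower i X v | tube-upper i X v | capL-lower Y v | capL-upper Y v | eqb-ne ne
     | ∨-identityʳ (lookup ZL v ∧ not (lookup Y v)) | ∨-identityʳ (lookup ZL v ∧ lookup Y v) | ff with lookup ZL v
  ... | false = refl , refl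
  ... | true rewrite bb refl = refl , refl
  tube-capR-agree : ∀ i X Y v → ¬ v ≡ wR → lookup (F i) v ≡ lookup ZR v → (lookup ZR v ≡ true → lookup X v ≡ lookup Y v) →
         lookup (lowerOf (tube i X)) v ≡ lookup (lowerOf (capR Y)) v × lookup (upperOf (tube i X)) v ≡ lookup (upperOf (capR Y)) v
  tube-capR-agree i X Y v ne ff bb rewrite tube-lower i X v | tube-upper i X v | capR-lower Y v | capR-upper Y v | eqb-ne ne
     | ∨-identityʳ (lookup ZR v ∧ not (lookup Y v)) | ∨-identityʳ (lookup ZR v ∧ lookup Y v) | ff with lookup ZR v
  ... | false = refl , refl
  ... | true rewrite bb refl = refl , refl

  -- The other facet through the ridge (RA, RB) of facet D that omits copy c of u.
  record Partner (RA RB : Subset n) (D : Code) (u : Fin n) (c : Bool) : Set where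
    field
      vertex : Fin n
      copy : Bool
      code : Code
      valid : Valid code
      extends : Extends RA RB (lowerOf code) (upperOf code) vertex copy
      distinct : ¬ (vertex ≡ u × copy ≡ c)
      level≤ : level code ≤ suc (level D)
      unique : ∀ D'' → Valid D'' → ∀ u'' c'' → Extends RA RB (lowerOf D'') (upperOf D'') u'' c'' → (u'' ≡ u × c'' ≡ c) ⊎ (u'' ≡ vertex × c'' ≡ copy)

  flip-in-tube : ∀ {RA RB : Subset n} i X → Valid (tube i X) → ∀ u c → Extends RA RB (lowerOf (tube i X)) (upperOf (tube i X)) u c →
       ¬ u ≡ ℓ i → ¬ u ≡ e i → Partner RA RB (tube i X) u c
  flip-in-tube {RA} {RB} i X (iδ , vX) u c hK nℓ ne = record
    { vertex = u ; copy = not c ; code = tube i X^ ; valid = (iδ , vX^) ; extends = rel ; distinct = λ p → notc (proj₂ p)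
    ; level≤ = n≤1+n _ ; unique = uq }
    where
    fu = proj₁ (tube-side i X c u (Extends.added hK))
    xu = proj₂ (tube-side i X c u (Extends.added hK))
    X^ = update X u (not c)
    vX^ : lookup X^ (ℓ i) ≡ lookup X^ (e i)
    vX^ = trans (update-other X u (not c) (ℓ i) (λ r → nℓ (sym r))) (trans vX (sym (update-other X u (not c) (e i) (λ r → ne (sym r)))))
    notc : ¬ not c ≡ c
    notc = not-≢ c
    Remp = Extends-absent hK (tube-disjoint i X u)
    rel : Extends RA RB (lowerOf (tube i X^)) (upperOf (tube i X^)) u (not c)
    rel = Extends-single u (not c)
      (λ v q → SameAt-trans {A = lowerOf (tube i X^)} {B = upperOf (tube i X^)} {A' = lowerOf (tube i X)} {B' = upperOf (tube i X)} {A'' = RA} {B'' = RB}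
                 (tube-tube-agree i X^ i X v refl (λ _ → update-other X u (not c) v q)) (Extends.agree hK v q))
      (subst (λ b → sideAt b (lowerOf (tube i X^)) (upperOf (tube i X^)) u ≡ true) (update-same X u (not c)) (tube-side-of i X^ u fu))
      (tube-disjoint i X^ u) (proj₁ Remp) (proj₂ Remp)
    uq : ∀ D'' → Valid D'' → ∀ u'' c'' → Extends RA RB (lowerOf D'') (upperOf D'') u'' c'' → (u'' ≡ u × c'' ≡ c) ⊎ (u'' ≡ u × c'' ≡ not c)
    uq D'' vD u'' c'' hH with same-point? u u'' c c''
    ... | inj₁ s = inj₁ s
    uq (tube j Y) vD u'' c'' hH | inj₂ dist with tube-tube-rivals i X j Y u c u'' c'' (iδ , vX) vD hK hH dist
    ... | inj₁ (_ , a , b , _) = inj₂ (a , b)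
    ... | inj₂ (inj₁ (_ , a , _)) = ⊥-elim (nℓ a)
    ... | inj₂ (inj₂ (_ , a , _)) = ⊥-elim (ne a)
    uq (capL Y) vD u'' c'' hH | inj₂ dist with tube-capL-rivals i X Y u c u'' c'' (iδ , vX) hK hH dist
    ... | i0 , a , _ = ⊥-elim (ne (trans a (cong e (sym i0))))
    uq (capR Y) vD u'' c'' hH | inj₂ dist with tube-capR-rivals i X Y u c u'' c'' (iδ , vX) hK hH dist
    ... | iD , a , _ = ⊥-elim (nℓ (trans a (cong ℓ (sym iD))))

  tube-outside : ∀ j Y v → lookup (F j) v ≡ false → lookup (lowerOf (tube j Y)) v ≡ false × lookup (upperOf (tube j Y)) v ≡ false
  tube-outside j Y v h rewrite tube-lower j Y v | tube-upper j Y v | h = refl , refl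

  tube-ascend : ∀ {RA RB : Subset n} i X → Valid (tube i X) → ∀ u c → Extends RA RB (lowerOf (tube i X)) (upperOf (tube i X)) u c →
       u ≡ ℓ i → suc i ≤ δ → Partner RA RB (tube i X) u c
  tube-ascend {RA} {RB} i X (iδ , vX) u c hK uℓ lt = record
    { vertex = e (suc i) ; copy = b ; code = tube (suc i) X' ; valid = (lt , vX') ; extends = rel ; distinct = λ p → eu (proj₁ p)
    ; level≤ = ≤-refl ; unique = uq }
    where
    fu = proj₁ (tube-side i X c u (Extends.added hK))
    b = lookup X (ℓ (suc i))
    X' = update X (e (suc i)) b
    vX' : lookup X' (ℓ (suc i)) ≡ lookup X' (e (suc i))
    vX' = trans (update-other X (e (suc i)) b (ℓ (suc i)) (λ r → e≢ℓ (suc i) lt (sym r))) (sym (update-same X (e (suc i)) b))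
    Remp = Extends-absent hK (tube-disjoint i X u)
    eu : ¬ e (suc i) ≡ u
    eu = λ r → ≢-by-membership (F i) fu (e∉ i lt) (sym r)
    rel : Extends RA RB (lowerOf (tube (suc i) X')) (upperOf (tube (suc i) X')) (e (suc i)) b
    rel = Extends-single (e (suc i)) b o
      (subst (λ b → sideAt b (lowerOf (tube (suc i) X')) (upperOf (tube (suc i) X')) (e (suc i)) ≡ true) (update-same X (e (suc i)) b) (tube-side-of (suc i) X' (e (suc i)) (e∈ (suc i) lt)))
      (tube-disjoint (suc i) X' (e (suc i)))
      (trans (sym (proj₁ Re)) (proj₁ Ke)) (trans (sym (proj₂ Re)) (proj₂ Ke))
      where
      Re = Extends.agree hK (e (suc i)) eu
      Ke = tube-outside i X (e (suc i)) (e∉ i lt)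
      o : ∀ v → ¬ v ≡ e (suc i) → lookup (lowerOf (tube (suc i) X')) v ≡ lookup RA v × lookup (upperOf (tube (suc i) X')) v ≡ lookup RB v
      o v q with v ≟F u
      ... | yes refl = trans (proj₁ Te) (sym (proj₁ Remp)) , trans (proj₂ Te) (sym (proj₂ Remp))
        where
        Te = tube-outside (suc i) X' v (subst (λ t → lookup (F (suc i)) t ≡ false) (sym uℓ) (ℓ∉ i lt))
      ... | no r = SameAt-trans {A = lowerOf (tube (suc i) X')} {B = upperOf (tube (suc i) X')} {A' = lowerOf (tube i X)} {B' = upperOf (tube i X)} {A'' = RA} {B'' = RB}
                 (tube-tube-agree (suc i) X' i X v (sym (F-step i lt v (λ s → r (trans s (sym uℓ))) q)) (λ _ → update-other X (e (suc i)) b v q)) (Extends.agree hK v r)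
    uq : ∀ D'' → Valid D'' → ∀ u'' c'' → Extends RA RB (lowerOf D'') (upperOf D'') u'' c'' → (u'' ≡ u × c'' ≡ c) ⊎ (u'' ≡ e (suc i) × c'' ≡ b)
    uq D'' vD u'' c'' hH with same-point? u u'' c c''
    ... | inj₁ s = inj₁ s
    uq (tube j Y) vD u'' c'' hH | inj₂ dist with tube-tube-rivals i X j Y u c u'' c'' (iδ , vX) vD hK hH dist
    ... | inj₁ (_ , _ , _ , a , _) = ⊥-elim (a uℓ)
    ... | inj₂ (inj₁ (refl , _ , a , bb)) = inj₂ (a , bb)
    ... | inj₂ (inj₂ (_ , a , _)) = ⊥-elim (e≢ℓ i iδ (trans (sym a) uℓ))
    uq (capL Y) vD u'' c'' hH | inj₂ dist with tube-capL-rivals i X Y u c u'' c'' (iδ , vX) hK hH dist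
    ... | i0 , a , _ = ⊥-elim (e≢ℓ 0 z≤n (trans (sym a) (trans uℓ (cong ℓ i0))))
    uq (capR Y) vD u'' c'' hH | inj₂ dist with tube-capR-rivals i X Y u c u'' c'' (iδ , vX) hK hH dist
    ... | iD , _ = ⊥-elim (<-irrefl iD lt)

  tube-descend : ∀ {RA RB : Subset n} k X → Valid (tube (suc k) X) → ∀ u c → Extends RA RB (lowerOf (tube (suc k) X)) (upperOf (tube (suc k) X)) u c →
       u ≡ e (suc k) → Partner RA RB (tube (suc k) X) u c
  tube-descend {RA} {RB} k X (iδ , vX) u c hK ue = record
    { vertex = ℓ k ; copy = b ; code = tube k X' ; valid = (kδ , vX') ; extends = rel ; distinct = λ p → ℓu (proj₁ p)
    ; level≤ = m≤n⇒m≤1+n (n≤1+n _) ; unique = uq }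
    where
    lt : k < δ
    lt = iδ
    kδ : k ≤ δ
    kδ = ≤-trans (n≤1+n k) iδ
    fu = proj₁ (tube-side (suc k) X c u (Extends.added hK))
    b = lookup X (e k)
    X' = update X (ℓ k) b
    vX' : lookup X' (ℓ k) ≡ lookup X' (e k)
    vX' = trans (update-same X (ℓ k) b) (sym (update-other X (ℓ k) b (e k) (e≢ℓ k kδ)))
    Remp = Extends-absent hK (tube-disjoint (suc k) X u)
    ℓu : ¬ ℓ k ≡ u
    ℓu = λ r → ≢-by-membership (F (suc k)) fu (ℓ∉ k lt) (sym r)
    rel : Extends RA RB (lowerOf (tube k X')) (upperOf (tube k X')) (ℓ k) b
    rel = Extends-single (ℓ k) b o
      (subst (λ b → sideAt b (lowerOf (tube k X')) (upperOf (tube k X')) (ℓ k) ≡ true) (update-same X (ℓ k) b) (tube-side-of k X' (ℓ k) (ℓ∈ k kδ)))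
      (tube-disjoint k X' (ℓ k))
      (trans (sym (proj₁ Re)) (proj₁ Ke)) (trans (sym (proj₂ Re)) (proj₂ Ke))
      where
      Re = Extends.agree hK (ℓ k) ℓu
      Ke = tube-outside (suc k) X (ℓ k) (ℓ∉ k lt)
      o : ∀ v → ¬ v ≡ ℓ k → lookup (lowerOf (tube k X')) v ≡ lookup RA v × lookup (upperOf (tube k X')) v ≡ lookup RB v
      o v q with v ≟F u
      ... | yes refl = trans (proj₁ Te) (sym (proj₁ Remp)) , trans (proj₂ Te) (sym (proj₂ Remp))
        where
        Te = tube-outside k X' v (subst (λ t → lookup (F k) t ≡ false) (sym ue) (e∉ k lt))
      ... | no r = SameAt-trans {A = lowerOf (tube k X')} {B = upperOf (tube k X')} {A' = lowerOf (tube (suc k) X)} {B' = upperOf (tube (suc k) X)} {A'' = RA} {B'' = RB}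
                 (tube-tube-agree k X' (suc k) X v (F-step k lt v q (λ s → r (trans s (sym ue)))) (λ _ → update-other X (ℓ k) b v q)) (Extends.agree hK v r)
    uq : ∀ D'' → Valid D'' → ∀ u'' c'' → Extends RA RB (lowerOf D'') (upperOf D'') u'' c'' → (u'' ≡ u × c'' ≡ c) ⊎ (u'' ≡ ℓ k × c'' ≡ b)
    uq D'' vD u'' c'' hH with same-point? u u'' c c''
    ... | inj₁ s = inj₁ s
    uq (tube j Y) vD u'' c'' hH | inj₂ dist with tube-tube-rivals (suc k) X j Y u c u'' c'' (iδ , vX) vD hK hH dist
    ... | inj₁ (_ , _ , _ , _ , a) = ⊥-elim (a ue)
    ... | inj₂ (inj₁ (_ , a , _)) = ⊥-elim (e≢ℓ (suc k) iδ (trans (sym ue) a))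
    ... | inj₂ (inj₂ (refl , _ , a , bb)) = inj₂ (a , bb)
    uq (capL Y) vD u'' c'' hH | inj₂ dist with tube-capL-rivals (suc k) X Y u c u'' c'' (iδ , vX) hK hH dist
    ... | () , _
    uq (capR Y) vD u'' c'' hH | inj₂ dist with tube-capR-rivals (suc k) X Y u c u'' c'' (iδ , vX) hK hH dist
    ... | iD , a , _ = ⊥-elim (e≢ℓ (suc k) iδ (trans (sym ue) (trans a (cong ℓ (sym iD)))))

  capL-outside : ∀ Y v → ¬ v ≡ wL → lookup ZL v ≡ false → lookup (lowerOf (capL Y)) v ≡ false × lookup (upperOf (capL Y)) v ≡ false
  capL-outside Y v ne h rewrite capL-lower Y v | capL-upper Y v | eqb-ne ne | h = refl , refl
  capR-outside : ∀ Y v → ¬ v ≡ wR → lookup ZR v ≡ false → lookup (lowerOf (capR Y)) v ≡ false × lookup (upperOf (capR Y)) v ≡ false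
  capR-outside Y v ne h rewrite capR-lower Y v | capR-upper Y v | eqb-ne ne | h = refl , refl

  tube-to-capR : ∀ {RA RB : Subset n} X → Valid (tube δ X) → ∀ u c → Extends RA RB (lowerOf (tube δ X)) (upperOf (tube δ X)) u c →
       u ≡ ℓ δ → Partner RA RB (tube δ X) u c
  tube-to-capR {RA} {RB} X (iδ , vX) u c hK uℓ = record
    { vertex = wR ; copy = not (lookup X wR) ; code = capR X ; valid = tt ; extends = rel ; distinct = λ p → wR≢ℓ (trans (proj₁ p) uℓ)
    ; level≤ = ≤-refl ; unique = uq }
    where
    Remp = Extends-absent hK (tube-disjoint δ X u)
    wu : ¬ wR ≡ u
    wu r = wR≢ℓ (trans r uℓ)
    KwR = Extends.agree hK wR wu
    Kside : sideAt (lookup X wR) (lowerOf (tube δ X)) (upperOf (tube δ X)) wR ≡ true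
    Kside = tube-side-of δ X wR wR∈
    rel : Extends RA RB (lowerOf (capR X)) (upperOf (capR X)) wR (not (lookup X wR))
    rel = Extends-onto-double wR (not (lookup X wR)) o (proj₁ (capR-apex X)) (proj₂ (capR-apex X))
      (trans (sym (sideAt-agree (lowerOf (tube δ X)) (upperOf (tube δ X)) RA RB wR KwR (not (lookup X wR))))
             (other-side-empty (lookup X wR) (lowerOf (tube δ X)) (upperOf (tube δ X)) wR (tube-disjoint δ X wR) Kside))
      (trans (sym (sideAt-agree (lowerOf (tube δ X)) (upperOf (tube δ X)) RA RB wR KwR (not (not (lookup X wR)))))
             (subst (λ t → sideAt t (lowerOf (tube δ X)) (upperOf (tube δ X)) wR ≡ true) (sym (not-involutive (lookup X wR))) Kside))
      where
      o : ∀ v → ¬ v ≡ wR → lookup (lowerOf (capR X)) v ≡ lookup RA v × lookup (upperOf (capR X)) v ≡ lookup RB v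
      o v q with v ≟F u
      ... | yes refl = trans (proj₁ Te) (sym (proj₁ Remp)) , trans (proj₂ Te) (sym (proj₂ Remp))
        where
        Te = capR-outside X v q (subst (λ t → lookup ZR t ≡ false) (sym uℓ) ℓδ∉ZR)
      ... | no r = SameAt-trans {A = lowerOf (capR X)} {B = upperOf (capR X)} {A' = lowerOf (tube δ X)} {B' = upperOf (tube δ X)} {A'' = RA} {B'' = RB}
                 (SameAt-sym {A = lowerOf (tube δ X)} {B = upperOf (tube δ X)} {A' = lowerOf (capR X)} {B' = upperOf (capR X)}
                   (tube-capR-agree δ X X v q (sym (ZR-lookup-off v (λ s → r (trans s (sym uℓ))) q)) (λ _ → refl)))
                 (Extends.agree hK v r)
    uq : ∀ D'' → Valid D'' → ∀ u'' c'' → Extends RA RB (lowerOf D'') (upperOf D'') u'' c'' → (u'' ≡ u × c'' ≡ c) ⊎ (u'' ≡ wR × c'' ≡ not (lookup X wR))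
    uq D'' vD u'' c'' hH with same-point? u u'' c c''
    ... | inj₁ s = inj₁ s
    uq (tube j Y) vD u'' c'' hH | inj₂ dist with tube-tube-rivals δ X j Y u c u'' c'' (iδ , vX) vD hK hH dist
    ... | inj₁ (_ , _ , _ , a , _) = ⊥-elim (a uℓ)
    ... | inj₂ (inj₁ (refl , _)) = ⊥-elim (<-irrefl refl (proj₁ vD))
    ... | inj₂ (inj₂ (_ , a , _)) = ⊥-elim (e≢ℓ δ iδ (trans (sym a) uℓ))
    uq (capL Y) vD u'' c'' hH | inj₂ dist with tube-capL-rivals δ X Y u c u'' c'' (iδ , vX) hK hH dist
    ... | i0 , a , _ = ⊥-elim (e≢ℓ 0 z≤n (trans (sym a) (trans uℓ (cong ℓ i0))))
    uq (capR Y) vD u'' c'' hH | inj₂ dist with tube-capR-rivals δ X Y u c u'' c'' (iδ , vX) hK hH dist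
    ... | _ , _ , a , bb = inj₂ (a , bb)

  tube-to-capL : ∀ {RA RB : Subset n} X → Valid (tube 0 X) → ∀ u c → Extends RA RB (lowerOf (tube 0 X)) (upperOf (tube 0 X)) u c →
       u ≡ e 0 → Partner RA RB (tube 0 X) u c
  tube-to-capL {RA} {RB} X (iδ , vX) u c hK ue = record
    { vertex = wL ; copy = not (lookup X wL) ; code = capL X ; valid = tt ; extends = rel ; distinct = λ p → wL≢e (trans (proj₁ p) ue)
    ; level≤ = z≤n ; unique = uq }
    where
    Remp = Extends-absent hK (tube-disjoint 0 X u)
    wu : ¬ wL ≡ u
    wu r = wL≢e (trans r ue)
    KwL = Extends.agree hK wL wu
    Kside : sideAt (lookup X wL) (lowerOf (tube 0 X)) (upperOf (tube 0 X)) wL ≡ true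
    Kside = tube-side-of 0 X wL wL∈
    rel : Extends RA RB (lowerOf (capL X)) (upperOf (capL X)) wL (not (lookup X wL))
    rel = Extends-onto-double wL (not (lookup X wL)) o (proj₁ (capL-apex X)) (proj₂ (capL-apex X))
      (trans (sym (sideAt-agree (lowerOf (tube 0 X)) (upperOf (tube 0 X)) RA RB wL KwL (not (lookup X wL))))
             (other-side-empty (lookup X wL) (lowerOf (tube 0 X)) (upperOf (tube 0 X)) wL (tube-disjoint 0 X wL) Kside))
      (trans (sym (sideAt-agree (lowerOf (tube 0 X)) (upperOf (tube 0 X)) RA RB wL KwL (not (not (lookup X wL)))))
             (subst (λ t → sideAt t (lowerOf (tube 0 X)) (upperOf (tube 0 X)) wL ≡ true) (sym (not-involutive (lookup X wL))) Kside))
      where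
      o : ∀ v → ¬ v ≡ wL → lookup (lowerOf (capL X)) v ≡ lookup RA v × lookup (upperOf (capL X)) v ≡ lookup RB v
      o v q with v ≟F u
      ... | yes refl = trans (proj₁ Te) (sym (proj₁ Remp)) , trans (proj₂ Te) (sym (proj₂ Remp))
        where
        Te = capL-outside X v q (subst (λ t → lookup ZL t ≡ false) (sym ue) e0∉ZL)
      ... | no r = SameAt-trans {A = lowerOf (capL X)} {B = upperOf (capL X)} {A' = lowerOf (tube 0 X)} {B' = upperOf (tube 0 X)} {A'' = RA} {B'' = RB}
                 (SameAt-sym {A = lowerOf (tube 0 X)} {B = upperOf (tube 0 X)} {A' = lowerOf (capL X)} {B' = upperOf (capL X)}
                   (tube-capL-agree 0 X X v q (sym (ZL-lookup-off v (λ s → r (trans s (sym ue))) q)) (λ _ → refl)))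
                 (Extends.agree hK v r)
    uq : ∀ D'' → Valid D'' → ∀ u'' c'' → Extends RA RB (lowerOf D'') (upperOf D'') u'' c'' → (u'' ≡ u × c'' ≡ c) ⊎ (u'' ≡ wL × c'' ≡ not (lookup X wL))
    uq D'' vD u'' c'' hH with same-point? u u'' c c''
    ... | inj₁ s = inj₁ s
    uq (tube j Y) vD u'' c'' hH | inj₂ dist with tube-tube-rivals 0 X j Y u c u'' c'' (iδ , vX) vD hK hH dist
    ... | inj₁ (_ , _ , _ , _ , a) = ⊥-elim (a ue)
    ... | inj₂ (inj₁ (_ , a , _)) = ⊥-elim (e≢ℓ 0 z≤n (trans (sym ue) a))
    ... | inj₂ (inj₂ (() , _))
    uq (capL Y) vD u'' c'' hH | inj₂ dist with tube-capL-rivals 0 X Y u c u'' c'' (iδ , vX) hK hH dist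
    ... | _ , _ , a , bb = inj₂ (a , bb)
    uq (capR Y) vD u'' c'' hH | inj₂ dist with tube-capR-rivals 0 X Y u c u'' c'' (iδ , vX) hK hH dist
    ... | iD , a , _ = ⊥-elim (e≢ℓ 0 z≤n (trans (sym ue) (trans a (cong ℓ (sym iD)))))

  capL-side-of : ∀ Y v → ¬ v ≡ wL → lookup ZL v ≡ true → sideAt (lookup Y v) (lowerOf (capL Y)) (upperOf (capL Y)) v ≡ true
  capL-side-of Y v ne h with lookup Y v in eq
  ... | false rewrite capL-lower Y v | eqb-ne ne | h | eq = refl
  ... | true rewrite capL-upper Y v | eqb-ne ne | h | eq = refl
  capR-side-of : ∀ Y v → ¬ v ≡ wR → lookup ZR v ≡ true → sideAt (lookup Y v) (lowerOf (capR Y)) (upperOf (capR Y)) v ≡ true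
  capR-side-of Y v ne h with lookup Y v in eq
  ... | false rewrite capR-lower Y v | eqb-ne ne | h | eq = refl
  ... | true rewrite capR-upper Y v | eqb-ne ne | h | eq = refl

  flip-in-capL : ∀ {RA RB : Subset n} X u c → Extends RA RB (lowerOf (capL X)) (upperOf (capL X)) u c → ¬ u ≡ wL → Partner RA RB (capL X) u c
  flip-in-capL {RA} {RB} X u c hK nw = record
    { vertex = u ; copy = not c ; code = capL X^ ; valid = tt ; extends = rel ; distinct = λ p → not-≢ c (proj₂ p)
    ; level≤ = z≤n ; unique = uq }
    where
    zu = proj₁ (capL-side X c u nw (Extends.added hK))
    X^ = update X u (not c)
    Remp = Extends-absent hK (capL-disjoint X u nw)
    rel : Extends RA RB (lowerOf (capL X^)) (upperOf (capL X^)) u (not c)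
    rel = Extends-single u (not c)
      (λ v q → SameAt-trans {A = lowerOf (capL X^)} {B = upperOf (capL X^)} {A' = lowerOf (capL X)} {B' = upperOf (capL X)} {A'' = RA} {B'' = RB}
                 (capL-capL-agree X^ X v (λ _ → update-other X u (not c) v q)) (Extends.agree hK v q))
      (subst (λ b → sideAt b (lowerOf (capL X^)) (upperOf (capL X^)) u ≡ true) (update-same X u (not c)) (capL-side-of X^ u nw zu))
      (capL-disjoint X^ u nw) (proj₁ Remp) (proj₂ Remp)
    uq : ∀ D'' → Valid D'' → ∀ u'' c'' → Extends RA RB (lowerOf D'') (upperOf D'') u'' c'' → (u'' ≡ u × c'' ≡ c) ⊎ (u'' ≡ u × c'' ≡ not c)
    uq D'' vD u'' c'' hH with same-point? u u'' c c''
    ... | inj₁ s = inj₁ s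
    uq (tube j Y) vD u'' c'' hH | inj₂ dist with tube-capL-rivals j Y X u'' c'' u c vD hH hK (λ p → dist (sym (proj₁ p) , sym (proj₂ p)))
    ... | _ , _ , a , _ = ⊥-elim (nw a)
    uq (capL Y) vD u'' c'' hH | inj₂ dist with capL-capL-rivals X Y u c u'' c'' hK hH dist
    ... | a , b , _ = inj₂ (a , b)
    uq (capR Y) vD u'' c'' hH | inj₂ dist = ⊥-elim (capL-capR-disjoint X Y u c u'' c'' hK hH)

  flip-in-capR : ∀ {RA RB : Subset n} X u c → Extends RA RB (lowerOf (capR X)) (upperOf (capR X)) u c → ¬ u ≡ wR → Partner RA RB (capR X) u c
  flip-in-capR {RA} {RB} X u c hK nw = record
    { vertex = u ; copy = not c ; code = capR X^ ; valid = tt ; extends = rel ; distinct = λ p → not-≢ c (proj₂ p)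
    ; level≤ = n≤1+n _ ; unique = uq }
    where
    zu = proj₁ (capR-side X c u nw (Extends.added hK))
    X^ = update X u (not c)
    Remp = Extends-absent hK (capR-disjoint X u nw)
    rel : Extends RA RB (lowerOf (capR X^)) (upperOf (capR X^)) u (not c)
    rel = Extends-single u (not c)
      (λ v q → SameAt-trans {A = lowerOf (capR X^)} {B = upperOf (capR X^)} {A' = lowerOf (capR X)} {B' = upperOf (capR X)} {A'' = RA} {B'' = RB}
                 (capR-capR-agree X^ X v (λ _ → update-other X u (not c) v q)) (Extends.agree hK v q))
      (subst (λ b → sideAt b (lowerOf (capR X^)) (upperOf (capR X^)) u ≡ true) (update-same X u (not c)) (capR-side-of X^ u nw zu))
      (capR-disjoint X^ u nw) (proj₁ Remp) (proj₂ Remp)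
    uq : ∀ D'' → Valid D'' → ∀ u'' c'' → Extends RA RB (lowerOf D'') (upperOf D'') u'' c'' → (u'' ≡ u × c'' ≡ c) ⊎ (u'' ≡ u × c'' ≡ not c)
    uq D'' vD u'' c'' hH with same-point? u u'' c c''
    ... | inj₁ s = inj₁ s
    uq (tube j Y) vD u'' c'' hH | inj₂ dist with tube-capR-rivals j Y X u'' c'' u c vD hH hK (λ p → dist (sym (proj₁ p) , sym (proj₂ p)))
    ... | _ , _ , a , _ = ⊥-elim (nw a)
    uq (capR Y) vD u'' c'' hH | inj₂ dist with capR-capR-rivals X Y u c u'' c'' hK hH dist
    ... | a , b , _ = inj₂ (a , b)
    uq (capL Y) vD u'' c'' hH | inj₂ dist = ⊥-elim (capL-capR-disjoint Y X u'' c'' u c hH hK)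

  capL-to-tube : ∀ {RA RB : Subset n} X u c → Extends RA RB (lowerOf (capL X)) (upperOf (capL X)) u c → u ≡ wL → Partner RA RB (capL X) u c
  capL-to-tube {RA} {RB} X u c hK refl = record
    { vertex = e 0 ; copy = b ; code = tube 0 Xr' ; valid = (z≤n , vX') ; extends = rel ; distinct = λ p → wL≢e (sym (proj₁ p))
    ; level≤ = ≤-refl ; unique = uq }
    where
    Xr = update X wL (not c)
    b = lookup Xr (ℓ 0)
    Xr' = update Xr (e 0) b
    ℓe : ¬ ℓ 0 ≡ e 0
    ℓe r = e≢ℓ 0 z≤n (sym r)
    vX' : lookup Xr' (ℓ 0) ≡ lookup Xr' (e 0)
    vX' = trans (update-other Xr (e 0) b (ℓ 0) ℓe) (sym (update-same Xr (e 0) b))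
    Rs = Extends-double hK (proj₁ (capL-apex X)) (proj₂ (capL-apex X))
    T = tube 0 Xr'
    TwL : sideAt (not c) (lowerOf T) (upperOf T) wL ≡ true
    TwL = subst (λ t → sideAt t (lowerOf T) (upperOf T) wL ≡ true)
            (trans (update-other Xr (e 0) b wL wL≢e) (update-same X wL (not c))) (tube-side-of 0 Xr' wL wL∈)
    rel : Extends RA RB (lowerOf T) (upperOf T) (e 0) b
    rel = Extends-single (e 0) b o
      (subst (λ t → sideAt t (lowerOf T) (upperOf T) (e 0) ≡ true) (update-same Xr (e 0) b) (tube-side-of 0 Xr' (e 0) (e∈ 0 z≤n)))
      (tube-disjoint 0 Xr' (e 0))
      (trans (sym (proj₁ Re)) (proj₁ Ke)) (trans (sym (proj₂ Re)) (proj₂ Ke))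
      where
      Re = Extends.agree hK (e 0) (λ r → wL≢e (sym r))
      Ke = capL-outside X (e 0) (λ r → wL≢e (sym r)) e0∉ZL
      o : ∀ v → ¬ v ≡ e 0 → lookup (lowerOf T) v ≡ lookup RA v × lookup (upperOf T) v ≡ lookup RB v
      o v q with v ≟F wL
      ... | yes refl = SameAt-from-sides (not c) (lowerOf T) (upperOf T) RA RB wL (trans TwL (sym (proj₁ Rs)))
                         (trans (other-side-empty (not c) (lowerOf T) (upperOf T) wL (tube-disjoint 0 Xr' wL) TwL)
                           (sym (subst (λ t → sideAt t RA RB wL ≡ false) (sym (not-involutive c)) (proj₂ Rs))))
      ... | no r = SameAt-trans {A = lowerOf T} {B = upperOf T} {A' = lowerOf (capL X)} {B' = upperOf (capL X)} {A'' = RA} {B'' = RB}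
                 (tube-capL-agree 0 Xr' X v r (sym (ZL-lookup-off v q r)) (λ _ → trans (update-other Xr (e 0) b v q) (update-other X wL (not c) v r)))
                 (Extends.agree hK v r)
    RBℓ : lookup RB (ℓ 0) ≡ b
    RBℓ = trans (sym (proj₂ (Extends.agree rel (ℓ 0) ℓe))) (trans (tube-upper-bit 0 Xr' (ℓ 0) (ℓ∈ 0 z≤n)) (update-other Xr (e 0) b (ℓ 0) ℓe))
    uq : ∀ D'' → Valid D'' → ∀ u'' c'' → Extends RA RB (lowerOf D'') (upperOf D'') u'' c'' → (u'' ≡ wL × c'' ≡ c) ⊎ (u'' ≡ e 0 × c'' ≡ b)
    uq D'' vD u'' c'' hH with same-point? wL u'' c c''
    ... | inj₁ s = inj₁ s
    uq (tube j Y) vD u'' c'' hH | inj₂ dist with tube-capL-rivals j Y X u'' c'' wL c vD hH hK (λ p → dist (sym (proj₁ p) , sym (proj₂ p)))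
    ... | refl , a , _ , _ = inj₂ (a , cc)
      where
      cc : c'' ≡ b
      cc = trans (sym (proj₂ (tube-side 0 Y c'' u'' (Extends.added hH)))) (trans (cong (lookup Y) a) (trans (sym (proj₂ vD))
             (trans (sym (tube-upper-bit 0 Y (ℓ 0) (ℓ∈ 0 z≤n))) (trans (proj₂ (Extends.agree hH (ℓ 0) (λ r → ℓe (trans r a)))) RBℓ))))
    uq (capL Y) vD u'' c'' hH | inj₂ dist with capL-capL-rivals X Y wL c u'' c'' hK hH dist
    ... | _ , _ , a = ⊥-elim (a refl)
    uq (capR Y) vD u'' c'' hH | inj₂ dist = ⊥-elim (capL-capR-disjoint X Y wL c u'' c'' hK hH)

  capR-to-tube : ∀ {RA RB : Subset n} X u c → Extends RA RB (lowerOf (capR X)) (upperOf (capR X)) u c → u ≡ wR → Partner RA RB (capR X) u c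
  capR-to-tube {RA} {RB} X u c hK refl = record
    { vertex = ℓ δ ; copy = b ; code = tube δ Xr' ; valid = (≤-refl , vX') ; extends = rel ; distinct = λ p → wR≢ℓ (sym (proj₁ p))
    ; level≤ = m≤n⇒m≤1+n (n≤1+n _) ; unique = uq }
    where
    Xr = update X wR (not c)
    b = lookup Xr (e δ)
    Xr' = update Xr (ℓ δ) b
    eℓ : ¬ e δ ≡ ℓ δ
    eℓ = e≢ℓ δ ≤-refl
    vX' : lookup Xr' (ℓ δ) ≡ lookup Xr' (e δ)
    vX' = trans (update-same Xr (ℓ δ) b) (sym (update-other Xr (ℓ δ) b (e δ) eℓ))
    Rs = Extends-double hK (proj₁ (capR-apex X)) (proj₂ (capR-apex X))
    T = tube δ Xr'
    TwR : sideAt (not c) (lowerOf T) (upperOf T) wR ≡ true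
    TwR = subst (λ t → sideAt t (lowerOf T) (upperOf T) wR ≡ true)
            (trans (update-other Xr (ℓ δ) b wR wR≢ℓ) (update-same X wR (not c))) (tube-side-of δ Xr' wR wR∈)
    rel : Extends RA RB (lowerOf T) (upperOf T) (ℓ δ) b
    rel = Extends-single (ℓ δ) b o
      (subst (λ t → sideAt t (lowerOf T) (upperOf T) (ℓ δ) ≡ true) (update-same Xr (ℓ δ) b) (tube-side-of δ Xr' (ℓ δ) (ℓ∈ δ ≤-refl)))
      (tube-disjoint δ Xr' (ℓ δ))
      (trans (sym (proj₁ Re)) (proj₁ Ke)) (trans (sym (proj₂ Re)) (proj₂ Ke))
      where
      Re = Extends.agree hK (ℓ δ) (λ r → wR≢ℓ (sym r))
      Ke = capR-outside X (ℓ δ) (λ r → wR≢ℓ (sym r)) ℓδ∉ZR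
      o : ∀ v → ¬ v ≡ ℓ δ → lookup (lowerOf T) v ≡ lookup RA v × lookup (upperOf T) v ≡ lookup RB v
      o v q with v ≟F wR
      ... | yes refl = SameAt-from-sides (not c) (lowerOf T) (upperOf T) RA RB wR (trans TwR (sym (proj₁ Rs)))
                         (trans (other-side-empty (not c) (lowerOf T) (upperOf T) wR (tube-disjoint δ Xr' wR) TwR)
                           (sym (subst (λ t → sideAt t RA RB wR ≡ false) (sym (not-involutive c)) (proj₂ Rs))))
      ... | no r = SameAt-trans {A = lowerOf T} {B = upperOf T} {A' = lowerOf (capR X)} {B' = upperOf (capR X)} {A'' = RA} {B'' = RB}
                 (tube-capR-agree δ Xr' X v r (sym (ZR-lookup-off v q r)) (λ _ → trans (update-other Xr (ℓ δ) b v q) (update-other X wR (not c) v r)))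
                 (Extends.agree hK v r)
    RBe : lookup RB (e δ) ≡ b
    RBe = trans (sym (proj₂ (Extends.agree rel (e δ) eℓ))) (trans (tube-upper-bit δ Xr' (e δ) (e∈ δ ≤-refl)) (update-other Xr (ℓ δ) b (e δ) eℓ))
    uq : ∀ D'' → Valid D'' → ∀ u'' c'' → Extends RA RB (lowerOf D'') (upperOf D'') u'' c'' → (u'' ≡ wR × c'' ≡ c) ⊎ (u'' ≡ ℓ δ × c'' ≡ b)
    uq D'' vD u'' c'' hH with same-point? wR u'' c c''
    ... | inj₁ s = inj₁ s
    uq (tube j Y) vD u'' c'' hH | inj₂ dist with tube-capR-rivals j Y X u'' c'' wR c vD hH hK (λ p → dist (sym (proj₁ p) , sym (proj₂ p)))
    ... | refl , a , _ , _ = inj₂ (a , cc)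
      where
      cc : c'' ≡ b
      cc = trans (sym (proj₂ (tube-side δ Y c'' u'' (Extends.added hH)))) (trans (cong (lookup Y) a) (trans (proj₂ vD)
             (trans (sym (tube-upper-bit δ Y (e δ) (e∈ δ ≤-refl))) (trans (proj₂ (Extends.agree hH (e δ) (λ r → eℓ (trans r a)))) RBe))))
    uq (capR Y) vD u'' c'' hH | inj₂ dist with capR-capR-rivals X Y wR c u'' c'' hK hH dist
    ... | _ , _ , a = ⊥-elim (a refl)
    uq (capL Y) vD u'' c'' hH | inj₂ dist = ⊥-elim (capL-capR-disjoint Y X u'' c'' wR c hH hK)

  partner : ∀ {RA RB : Subset n} D → Valid D → ∀ u c → Extends RA RB (lowerOf D) (upperOf D) u c → Partner RA RB D u c
  partner (tube i X) v u c hK with u ≟F ℓ i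
  ... | yes uℓ with suc i ≤? δ
  ...   | yes lt = tube-ascend i X v u c hK uℓ lt
  ...   | no nlt with ≤-suc-≢⇒≡ i δ (proj₁ v) (≤-trans (n≤1+n δ) (≰⇒> nlt)) (λ r → nlt (≤-reflexive r))
  ...     | refl = tube-to-capR X v u c hK uℓ
  partner (tube i X) v u c hK | no nℓ with u ≟F e i
  partner (tube zero X) v u c hK | no nℓ | yes ue = tube-to-capL X v u c hK ue
  partner (tube (suc k) X) v u c hK | no nℓ | yes ue = tube-descend k X v u c hK ue
  partner (tube i X) v u c hK | no nℓ | no ne = flip-in-tube i X v u c hK nℓ ne
  partner (capL X) v u c hK with u ≟F wL
  ... | yes q = capL-to-tube X u c hK q
  ... | no q = flip-in-capL X u c hK q
  partner (capR X) v u c hK with u ≟F wR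
  ... | yes q = capR-to-tube X u c hK q
  ... | no q = flip-in-capR X u c hK q

module PseudoManifold {n d : ℕ} (π : GeodesicPath n d) where
  open GeodesicPath π
  open Construction π
  open Ridges π
  open Doubling n
  open Walks d P

  lowerPart-facet : ∀ D → lowerPart (facet D) ≡ lowerOf D
  lowerPart-facet D = lowerPart-glue (lowerOf D) (upperOf D)
  upperPart-facet : ∀ D → upperPart (facet D) ≡ upperOf D
  upperPart-facet D = upperPart-glue (lowerOf D) (upperOf D)

  ridge-Extends : ∀ (R : Subset (2 * n)) D → R ⊑ facet D → ∣ facet D ∣ ≡ suc ∣ R ∣ →
          Σ (Fin n) λ u → Σ Bool λ c → Extends (lowerPart R) (upperPart R) (lowerOf D) (upperOf D) u c
  ridge-Extends R D sub cd with ⊑-suc⇒Extends R (facet D) sub cd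
  ... | u , c , h = u , c , subst₂ (λ A B → Extends (lowerPart R) (upperPart R) A B u c) (lowerPart-facet D) (upperPart-facet D) h

  Extends⇒⊑facet : ∀ (R : Subset (2 * n)) D {u c} → Extends (lowerPart R) (upperPart R) (lowerOf D) (upperOf D) u c → R ⊑ facet D
  Extends⇒⊑facet R D h = ⊑-from-parts {R} {facet D} (subst (lowerPart R ⊑_) (sym (lowerPart-facet D)) (proj₁ (Extends⇒⊑ h)))
                                      (subst (upperPart R ⊑_) (sym (upperPart-facet D)) (proj₂ (Extends⇒⊑ h)))

  Extends-same-point : ∀ (R : Subset (2 * n)) D D′ {u c} → Extends (lowerPart R) (upperPart R) (lowerOf D) (upperOf D) u c → Extends (lowerPart R) (upperPart R) (lowerOf D′) (upperOf D′) u c → facet D ≡ facet D′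
  Extends-same-point R D D′ h h' with Extends-deterministic h h'
  ... | a , b = cong₂ glue a b

  Extends-other-point : ∀ (R : Subset (2 * n)) D D′ {u c u' c'} → Extends (lowerPart R) (upperPart R) (lowerOf D) (upperOf D) u c → Extends (lowerPart R) (upperPart R) (lowerOf D′) (upperOf D′) u' c' →
          ¬ (u' ≡ u × c' ≡ c) → ¬ facet D ≡ facet D′
  Extends-other-point R D D′ {u} {c} {u'} {c'} h h' ne eq with glue-injective eq
  ... | a , b = ne (sym (proj₁ i) , sym (proj₂ i))
    where
    i = Extends-point-unique h (subst₂ (λ A B → Extends (lowerPart R) (upperPart R) A B u' c') (sym a) (sym b) h')

  facet-card-ridge : ∀ (R : Subset (2 * n)) D → Valid D → R ⊑ facet D → suc ∣ R ∣ ≡ d → ∣ facet D ∣ ≡ suc ∣ R ∣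
  facet-card-ridge R D v sub e = trans (facet-pure D v) (sym e)

  ridge-in-two-facets : ∀ R → IsRidge d P R →
    Σ (Subset (2 * n)) λ F' → Σ (Subset (2 * n)) λ G →
      F' ∈C P × G ∈C P × ¬ F' ≡ G × R ⊆ F' × R ⊆ G ×
      (∀ H → H ∈C P → R ⊆ H → H ≡ F' ⊎ H ≡ G)
  ridge-in-two-facets R (cR , K , KP , RK) with ∈P⇒facet K KP
  ... | D , vD , refl with ridge-Extends R D (⊆⇒⊑ RK) (facet-card-ridge R D vD (⊆⇒⊑ RK) cR)
  ... | u , c , hK = facet D , facet D′ , KP , facet∈P D′ (Partner.valid p) , Extends-other-point R D D′ hK (Partner.extends p) (Partner.distinct p) ,
                     RK , ⊑⇒⊆ (Extends⇒⊑facet R D′ (Partner.extends p)) , uq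
    where
    p = partner D vD u c hK
    D′ = Partner.code p
    uq : ∀ H → H ∈C P → R ⊆ H → H ≡ facet D ⊎ H ≡ facet D′
    uq H HP RH with ∈P⇒facet H HP
    ... | D'' , vD'' , refl with ridge-Extends R D'' (⊆⇒⊑ RH) (facet-card-ridge R D'' vD'' (⊆⇒⊑ RH) cR)
    ... | u'' , c'' , hH with Partner.unique p D'' vD'' u'' c'' hH
    ... | inj₁ (refl , refl) = inj₁ (Extends-same-point R D'' D hH hK)
    ... | inj₂ (refl , refl) = inj₂ (Extends-same-point R D'' D′ hH (Partner.extends p))

  ridgeAt : Code → Fin n → Bool → Subset (2 * n)
  ridgeAt D u c = glue (removeLower (lowerOf D) u c) (removeUpper (upperOf D) u c)

  ridgeAt-Extends : ∀ D u c → sideAt c (lowerOf D) (upperOf D) u ≡ true → Extends (lowerPart (ridgeAt D u c)) (upperPart (ridgeAt D u c)) (lowerOf D) (upperOf D) u c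
  ridgeAt-Extends D u c s = subst₂ (λ A B → Extends A B (lowerOf D) (upperOf D) u c) (sym (lowerPart-glue (removeLower (lowerOf D) u c) (removeUpper (upperOf D) u c)))
                   (sym (upperPart-glue (removeLower (lowerOf D) u c) (removeUpper (upperOf D) u c))) (remove-Extends (lowerOf D) (upperOf D) u c s)

  partner-adjacent : ∀ D → Valid D → ∀ u c → (s : sideAt c (lowerOf D) (upperOf D) u ≡ true) → (p : Partner (lowerPart (ridgeAt D u c)) (upperPart (ridgeAt D u c)) D u c) →
          Adjacent d P (facet D) (facet (Partner.code p))
  partner-adjacent D vD u c s p = facet∈P D vD , facet∈P D′ (Partner.valid p) ,
      Extends-other-point R D D′ hK' (Partner.extends p) (Partner.distinct p) , R , cR , ⊑⇒⊆ (Extends⇒⊑facet R D hK') , ⊑⇒⊆ (Extends⇒⊑facet R D′ (Partner.extends p))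
    where
    RA = removeLower (lowerOf D) u c
    RB = removeUpper (upperOf D) u c
    R = ridgeAt D u c
    hK' = ridgeAt-Extends D u c s
    D′ = Partner.code p
    cR : suc ∣ R ∣ ≡ d
    cR = trans (cong suc (card-glue RA RB)) (trans (sym (Extends-card (remove-Extends (lowerOf D) (upperOf D) u c s))) (trans (sym (card-glue (lowerOf D) (upperOf D))) (facet-pure D vD)))

  ∅ : Subset n
  ∅ = tabulate (λ _ → false)
  baseFacet : Subset (2 * n)
  baseFacet = facet (capL ∅)

  marked : Subset n → Subset n
  marked X = tabulate (λ v → lookup ZL v ∧ lookup X v)

  marked-lookup : ∀ X v → lookup (marked X) v ≡ (lookup ZL v ∧ lookup X v)
  marked-lookup X v = lookup∘tabulate _ v

  capL-reaches-base′ : ∀ k X → ∣ marked X ∣ ≡ k → Reachable (facet (capL X)) baseFacet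
  capL-reaches-base′ zero X h = subst (λ S → Reachable S baseFacet) (sym eq) (reachable-refl (facet∈P (capL ∅) tt))
    where
    bits : ∀ v → lookup ZL v ≡ true → lookup X v ≡ lookup ∅ v
    bits v z with lookup X v in eq'
    ... | false = sym (lookup∘tabulate (λ _ → false) v)
    ... | true = ⊥-elim (bit-clash (trans (marked-lookup X v) (trans (cong (_∧ lookup X v) z) eq')) (card≡0⇒empty (marked X) h v))
    eq : facet (capL X) ≡ facet (capL ∅)
    eq = cong₂ glue (lookup-ext (lowerOf (capL X)) (lowerOf (capL ∅)) (λ v → proj₁ (capL-capL-agree X ∅ v (bits v)))) (lookup-ext (upperOf (capL X)) (upperOf (capL ∅)) (λ v → proj₂ (capL-capL-agree X ∅ v (bits v))))
  capL-reaches-base′ (suc k) X h with nonempty-witness (marked X) (subst (0 <_) (sym h) (s≤s z≤n))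
  ... | v , xv = reachable-trans (reachable-adjacent (partner-adjacent (capL X) tt v true s p)) (capL-reaches-base′ k X' cnt)
    where
    zx = ∧-true {lookup ZL v} (trans (sym (marked-lookup X v)) xv)
    nw : ¬ v ≡ wL
    nw = proj₂ (proj₂ (ZL⁻ v (proj₁ zx)))
    s : sideAt true (lowerOf (capL X)) (upperOf (capL X)) v ≡ true
    s = subst (λ b → sideAt b (lowerOf (capL X)) (upperOf (capL X)) v ≡ true) (proj₂ zx) (capL-side-of X v nw (proj₁ zx))
    p = flip-in-capL X v true (ridgeAt-Extends (capL X) v true s) nw
    X' = update X v false
    cnt : ∣ marked X' ∣ ≡ k
    cnt = suc-injective (trans (sym (card-single-difference (marked X) (marked X') v
            (λ w ne → trans (marked-lookup X w) (trans (cong (lookup ZL w ∧_) (sym (update-other X v false w ne))) (sym (marked-lookup X' w))))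
            xv (trans (marked-lookup X' v) (trans (cong (lookup ZL v ∧_) (update-same X v false)) (∧-zeroʳ _))))) h)

  capL-reaches-base : ∀ X → Reachable (facet (capL X)) baseFacet
  capL-reaches-base X = capL-reaches-base′ _ X refl

  tube-reaches-base : ∀ i X → Valid (tube i X) → Reachable (facet (tube i X)) baseFacet
  tube-reaches-base zero X v = reachable-trans (reachable-adjacent (partner-adjacent (tube 0 X) v (e 0) (lookup X (e 0)) s p)) (capL-reaches-base X)
    where
    s = tube-side-of 0 X (e 0) (e∈ 0 z≤n)
    p = tube-to-capL X v (e 0) (lookup X (e 0)) (ridgeAt-Extends (tube 0 X) (e 0) (lookup X (e 0)) s) refl
  tube-reaches-base (suc k) X v = reachable-trans (reachable-adjacent (partner-adjacent (tube (suc k) X) v (e (suc k)) (lookup X (e (suc k))) s p)) (tube-reaches-base k _ (Partner.valid p))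
    where
    s = tube-side-of (suc k) X (e (suc k)) (e∈ (suc k) (proj₁ v))
    p = tube-descend k X v (e (suc k)) (lookup X (e (suc k))) (ridgeAt-Extends (tube (suc k) X) (e (suc k)) (lookup X (e (suc k))) s) refl

  capR-reaches-base : ∀ X → Reachable (facet (capR X)) baseFacet
  capR-reaches-base X = reachable-trans (reachable-adjacent (partner-adjacent (capR X) tt wR true s p)) (tube-reaches-base δ _ (Partner.valid p))
    where
    s = proj₂ (capR-apex X)
    p = capR-to-tube X wR true (ridgeAt-Extends (capR X) wR true s) refl

  reaches-base : ∀ D → Valid D → Reachable (facet D) baseFacet
  reaches-base (tube i X) v = tube-reaches-base i X v
  reaches-base (capL X) v = capL-reaches-base X
  reaches-base (capR X) v = capR-reaches-base X

  P-stronglyConnected : StronglyConnected d P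
  P-stronglyConnected S T SP TP with ∈P⇒facet S SP | ∈P⇒facet T TP
  ... | D , vD , refl | D′ , vD' , refl = reachable-trans (reaches-base D vD) (reachable-sym (reaches-base D′ vD'))

  level-unique : ∀ D D′ → Valid D → Valid D′ → facet D ≡ facet D′ → level D ≡ level D′
  level-unique D D′ vD vD' eq with glue-injective eq
  ... | a , b = go D D′ vD vD' a b
    where
    pat : ∀ {D D′} → lowerOf D ≡ lowerOf D′ → upperOf D ≡ upperOf D′ → ∀ v → lookup (lowerOf D) v ≡ lookup (lowerOf D′) v × lookup (upperOf D) v ≡ lookup (upperOf D′) v
    pat a b v = cong (λ S → lookup S v) a , cong (λ S → lookup S v) b
    go : ∀ D D′ → Valid D → Valid D′ → lowerOf D ≡ lowerOf D′ → upperOf D ≡ upperOf D′ → level D ≡ level D′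
    go (tube i X) (tube j Y) (iδ , _) (jδ , _) a b =
      cong suc (F-injective i j iδ jδ (lookup-ext (F i) (F j) (λ v → tube-support-agree i X j Y v (pat {tube i X} {tube j Y} a b v))))
    go (tube i X) (capL Y) _ _ a b = ⊥-elim (disjoint-clash {A = lowerOf (tube i X)} {B = upperOf (tube i X)} {v = wL}
        (trans (proj₁ (pat {tube i X} {capL Y} a b wL)) (proj₁ (capL-apex Y))) (trans (proj₂ (pat {tube i X} {capL Y} a b wL)) (proj₂ (capL-apex Y))) (tube-disjoint i X wL))
    go (tube i X) (capR Y) _ _ a b = ⊥-elim (disjoint-clash {A = lowerOf (tube i X)} {B = upperOf (tube i X)} {v = wR}
        (trans (proj₁ (pat {tube i X} {capR Y} a b wR)) (proj₁ (capR-apex Y))) (trans (proj₂ (pat {tube i X} {capR Y} a b wR)) (proj₂ (capR-apex Y))) (tube-disjoint i X wR))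
    go (capL X) (tube j Y) _ _ a b = ⊥-elim (disjoint-clash {A = lowerOf (tube j Y)} {B = upperOf (tube j Y)} {v = wL}
        (trans (sym (proj₁ (pat {capL X} {tube j Y} a b wL))) (proj₁ (capL-apex X))) (trans (sym (proj₂ (pat {capL X} {tube j Y} a b wL))) (proj₂ (capL-apex X))) (tube-disjoint j Y wL))
    go (capR X) (tube j Y) _ _ a b = ⊥-elim (disjoint-clash {A = lowerOf (tube j Y)} {B = upperOf (tube j Y)} {v = wR}
        (trans (sym (proj₁ (pat {capR X} {tube j Y} a b wR))) (proj₁ (capR-apex X))) (trans (sym (proj₂ (pat {capR X} {tube j Y} a b wR))) (proj₂ (capR-apex X))) (tube-disjoint j Y wR))
    go (capL X) (capL Y) _ _ a b = refl
    go (capR X) (capR Y) _ _ a b = refl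
    go (capL X) (capR Y) _ _ a b = ⊥-elim (disjoint-clash {A = lowerOf (capR Y)} {B = upperOf (capR Y)} {v = wL}
        (trans (sym (proj₁ (pat {capL X} {capR Y} a b wL))) (proj₁ (capL-apex X))) (trans (sym (proj₂ (pat {capL X} {capR Y} a b wL))) (proj₂ (capL-apex X))) (capR-disjoint Y wL wL≢wR))
    go (capR X) (capL Y) _ _ a b = ⊥-elim (disjoint-clash {A = lowerOf (capL Y)} {B = upperOf (capL Y)} {v = wR}
        (trans (sym (proj₁ (pat {capR X} {capL Y} a b wR))) (proj₁ (capR-apex X))) (trans (sym (proj₂ (pat {capR X} {capL Y} a b wR))) (proj₂ (capR-apex X))) (capL-disjoint Y wR (λ r → wL≢wR (sym r))))

  level-adjacent : ∀ D D1 → Valid D → Valid D1 → Adjacent d P (facet D) (facet D1) → level D1 ≤ suc (level D)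
  level-adjacent D D1 vD vD1 (_ , _ , ne , R , cR , RS , RS1) with ridge-Extends R D (⊆⇒⊑ RS) (facet-card-ridge R D vD (⊆⇒⊑ RS) cR)
  ... | u , c , hK with ridge-Extends R D1 (⊆⇒⊑ RS1) (facet-card-ridge R D1 vD1 (⊆⇒⊑ RS1) cR)
  ... | u1 , c1 , h1 with Partner.unique p D1 vD1 u1 c1 h1
    where p = partner D vD u c hK
  ... | inj₁ (refl , refl) = ⊥-elim (ne (Extends-same-point R D D1 hK h1))
  ... | inj₂ (refl , refl) = subst (_≤ suc (level D)) (level-unique (Partner.code p) D1 (Partner.valid p) vD1 (Extends-same-point R (Partner.code p) D1 (Partner.extends p) h1)) (Partner.level≤ p)
    where p = partner D vD u c hK

  level-walk : ∀ {S T m} → Walk d P S T m → ∀ D D′ → Valid D → Valid D′ → S ≡ facet D → T ≡ facet D′ → level D′ ≤ level D + m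
  level-walk (here _) D D′ vD vD' refl eq = ≤-trans (≤-reflexive (sym (level-unique D D′ vD vD' eq))) (m≤m+n _ 0)
  level-walk {m = suc m} (step {G = G} a w) D D′ vD vD' refl eqT with ∈P⇒facet G (proj₁ (proj₂ a))
  ... | D1 , vD1 , refl = ≤-trans (level-walk w D1 D′ vD1 vD' refl eqT)
      (≤-trans (+-monoˡ-≤ m (level-adjacent D D1 vD vD1 a)) (≤-reflexive (sym (+-suc (level D) m))))

  P-diameter : DiameterAtLeast d P (δ + 2)
  P-diameter = baseFacet , facet (capR ∅) , facet∈P (capL ∅) tt , facet∈P (capR ∅) tt ,
         λ m w → subst (_≤ m) (+-comm 2 δ) (level-walk w (capL ∅) (capR ∅) tt tt refl refl)

  P-pseudoManifold : IsPseudoManifold d P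
  P-pseudoManifold = (λ S SP → pureS S SP) , P-stronglyConnected , ridge-in-two-facets
    where
    pureS : ∀ S → S ∈C P → ∣ S ∣ ≡ d
    pureS S SP with ∈P⇒facet S SP
    ... | D , vD , refl = facet-pure D vD

-- A shortest path in C

module GeodesicFromWalk {n d : ℕ} (C : Complex n) (pure : IsPure d C) (2≤d : 2 ≤ d) (F0 G0 : Subset n) (δ : ℕ)
             (w : Walk d C F0 G0 δ) (minimal : ∀ m → Walk d C F0 G0 m → δ ≤ m) where
  open Walks d C

  F : ℕ → Subset n
  F = facetAt w

  F∈ : ∀ i → i ≤ δ → F i ∈C C
  F∈ i le = facetAt∈ w i le

  ∣F∣≡d : ∀ i → i ≤ δ → ∣ F i ∣ ≡ d
  ∣F∣≡d i le = pure (F i) (F∈ i le)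

  distance-from-start : ∀ i → i ≤ δ → ∀ m → Walk d C F0 (F i) m → i ≤ m
  distance-from-start i le m u = +-cancelʳ-≤ (δ ∸ i) i m (≤-trans (≤-reflexive (m+[n∸m]≡n le)) (minimal _ (walk-++ u (walk-suffix w i le))))

  geodesic : ∀ i j → i ≤ δ → j ≤ δ → (U : Subset n) → suc ∣ U ∣ ≡ d → U ⊑ F i → U ⊑ F j → j ≤ suc i
  geodesic i j iδ jδ U cU Ui Uj with ≡-decV _≟B_ (F i) (F j)
  ... | yes eq = m≤n⇒m≤1+n (distance-from-start j jδ i (subst (λ X → Walk d C F0 X i) eq (walk-prefix w i iδ)))
  ... | no ne = subst (j ≤_) (+-comm i 1)
          (distance-from-start j jδ (i + 1) (walk-++ (walk-prefix w i iδ) (step (F∈ i iδ , F∈ j jδ , ne , U , cU , ⊑⇒⊆ Ui , ⊑⇒⊆ Uj) (here (F∈ j jδ)))))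

  F-injective : ∀ i j → i ≤ δ → j ≤ δ → F i ≡ F j → i ≡ j
  F-injective i j iδ jδ eq = ≤-antisym (distance-from-start i iδ j (subst (λ X → Walk d C F0 X j) (sym eq) (walk-prefix w j jδ)))
                               (distance-from-start j jδ i (subst (λ X → Walk d C F0 X i) eq (walk-prefix w i iδ)))

  F-adjacent : ∀ i → suc i ≤ δ → Adjacent d C (F i) (F (suc i))
  F-adjacent i lt = facetAt-adjacent w i lt

  someVertex : Fin n
  someVertex = proj₁ (nonempty-witness (F 0) (≤-trans (s≤s z≤n) (≤-trans 2≤d (≤-reflexive (sym (∣F∣≡d 0 z≤n))))))

  same-size : ∀ i → suc i ≤ δ → ∣ F i ∣ ≡ ∣ F (suc i) ∣
  same-size i lt = trans (∣F∣≡d i (≤-trans (n≤1+n i) lt)) (sym (∣F∣≡d (suc i) lt))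

  -- For i ≥ δ, leaving i and entering i are the junk value someVertex.
  leaving : ℕ → Fin n
  leaving i with suc i ≤? δ
  ... | yes lt = proj₁ (difference-witness (F i) (F (suc i)) (same-size i lt) (proj₁ (proj₂ (proj₂ (F-adjacent i lt)))))
  ... | no _ = someVertex

  leaving-ok : ∀ i → suc i ≤ δ → lookup (F i) (leaving i) ≡ true × lookup (F (suc i)) (leaving i) ≡ false
  leaving-ok i lt with suc i ≤? δ
  ... | yes lt' = proj₂ (difference-witness (F i) (F (suc i)) (same-size i lt') (proj₁ (proj₂ (proj₂ (F-adjacent i lt')))))
  ... | no nl = ⊥-elim (nl lt)

  entering : ℕ → Fin n
  entering i with suc i ≤? δ
  ... | yes lt = proj₁ (difference-witness (F (suc i)) (F i) (sym (same-size i lt)) (λ e → proj₁ (proj₂ (proj₂ (F-adjacent i lt))) (sym e)))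
  ... | no _ = someVertex

  entering-ok : ∀ i → suc i ≤ δ → lookup (F (suc i)) (entering i) ≡ true × lookup (F i) (entering i) ≡ false
  entering-ok i lt with suc i ≤? δ
  ... | yes lt' = proj₂ (difference-witness (F (suc i)) (F i) (sym (same-size i lt')) (λ e → proj₁ (proj₂ (proj₂ (F-adjacent i lt'))) (sym e)))
  ... | no nl = ⊥-elim (nl lt)

  F-step : ∀ i → i < δ → ∀ v → ¬ v ≡ leaving i → ¬ v ≡ entering i → lookup (F i) v ≡ lookup (F (suc i)) v
  F-step i lt v n1 n2 with F-adjacent i lt
  ... | _ , _ , _ , R , cR , RF , RG = trans (⊑-suc-agree R (F i) (leaving i) (⊆⇒⊑ RF) cd1 (proj₁ (leaving-ok i lt)) rℓ v n1)
                                              (sym (⊑-suc-agree R (F (suc i)) (entering i) (⊆⇒⊑ RG) cd2 (proj₁ (entering-ok i lt)) re v n2))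
    where
    cd1 : ∣ F i ∣ ≡ suc ∣ R ∣
    cd1 = trans (∣F∣≡d i (≤-trans (n≤1+n i) lt)) (sym cR)
    cd2 : ∣ F (suc i) ∣ ≡ suc ∣ R ∣
    cd2 = trans (∣F∣≡d (suc i) lt) (sym cR)
    rℓ : lookup R (leaving i) ≡ false
    rℓ with lookup R (leaving i) in eq
    ... | true = ⊥-elim (true≢false (trans (sym (⊆⇒⊑ RG (leaving i) eq)) (proj₂ (leaving-ok i lt))))
    ... | false = refl
    re : lookup R (entering i) ≡ false
    re with lookup R (entering i) in eq
    ... | true = ⊥-elim (true≢false (trans (sym (⊆⇒⊑ RF (entering i) eq)) (proj₂ (entering-ok i lt))))
    ... | false = refl

  entering≢leaving : ∀ k → suc (suc k) ≤ δ → ¬ entering k ≡ leaving (suc k)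
  entering≢leaving k lt eq = ≤⇒≯ (geodesic k (suc (suc k)) (≤-trans (n≤1+n k) (≤-trans (n≤1+n (suc k)) lt)) lt U cU Uk Uk2) ≤-refl
    where
    lt1 : suc k ≤ δ
    lt1 = ≤-trans (n≤1+n (suc k)) lt
    x = entering k
    U = remove (F (suc k)) x
    cU : suc ∣ U ∣ ≡ d
    cU = trans (sym (card-remove (F (suc k)) x (proj₁ (entering-ok k lt1)))) (∣F∣≡d (suc k) lt1)
    Uk : U ⊑ F k
    Uk v h with remove⁻ (F (suc k)) x v h
    ... | fv , vx = trans (F-step k lt1 v (λ r → true≢false (trans (sym fv) (trans (cong (lookup (F (suc k))) r) (proj₂ (leaving-ok k lt1))))) vx) fv
    Uk2 : U ⊑ F (suc (suc k))
    Uk2 v h with remove⁻ (F (suc k)) x v h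
    ... | fv , vx = trans (sym (F-step (suc k) lt v n1 n2)) fv
      where
      n1 : ¬ v ≡ leaving (suc k)
      n1 r = vx (trans r (sym eq))
      n2 : ¬ v ≡ entering (suc k)
      n2 r = true≢false (trans (sym fv) (trans (cong (lookup (F (suc k))) r) (proj₂ (entering-ok (suc k) lt))))

  record Ends : Set where
    field
      e0 ℓδ wL wR : Fin n
      e0∈ : lookup (F 0) e0 ≡ true
      ℓδ∈ : lookup (F δ) ℓδ ≡ true
      e0ℓ : 0 < δ → ¬ e0 ≡ leaving 0
      ℓδe : ∀ k → suc k ≡ δ → ¬ ℓδ ≡ entering k
      δ0 : δ ≡ 0 → ¬ e0 ≡ ℓδ
      wL∈ : lookup (F 0) wL ≡ true
      wL≢e : ¬ wL ≡ e0
      wR∈ : lookup (F δ) wR ≡ true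
      wR≢ℓ : ¬ wR ≡ ℓδ
      wL≢wR : ¬ wL ≡ wR

  2≤∣F∣ : ∀ i → i ≤ δ → 2 ≤ ∣ F i ∣
  2≤∣F∣ i le = ≤-trans 2≤d (≤-reflexive (sym (∣F∣≡d i le)))

  ends-trivial : δ ≡ 0 → Ends
  ends-trivial eq0 = record
    { e0 = x ; ℓδ = y ; wL = y ; wR = x ; e0∈ = x∈ ; ℓδ∈ = toδ y∈ ; e0ℓ = λ lt → ⊥-elim (<-irrefl (sym eq0) lt)
    ; ℓδe = λ k e → ⊥-elim (0≢1+n (trans (sym eq0) (sym e))) ; δ0 = λ _ r → y≢x (sym r)
    ; wL∈ = y∈ ; wL≢e = y≢x ; wR∈ = toδ x∈ ; wR≢ℓ = λ r → y≢x (sym r) ; wL≢wR = y≢x }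
    where
    x = proj₁ (nonempty-witness (F 0) (≤-trans (s≤s z≤n) (2≤∣F∣ 0 z≤n)))
    x∈ = proj₂ (nonempty-witness (F 0) (≤-trans (s≤s z≤n) (2≤∣F∣ 0 z≤n)))
    y = proj₁ (pick-other (F 0) x (2≤∣F∣ 0 z≤n))
    y∈ = proj₁ (proj₂ (pick-other (F 0) x (2≤∣F∣ 0 z≤n)))
    y≢x = proj₂ (proj₂ (pick-other (F 0) x (2≤∣F∣ 0 z≤n)))
    toδ : ∀ {v} → lookup (F 0) v ≡ true → lookup (F δ) v ≡ true
    toδ {v} h = subst (λ k → lookup (F k) v ≡ true) (sym eq0) h

  -- If the vertex entering last is the one leaving first, {ℓ₀} is a (d-1)-set in F 0 and F δ;
  -- for d = 2 this forces δ = 1, where that vertex would both leave and enter F 1.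
  shared-end-vertex⇒3≤d : ∀ k → suc k ≡ δ → entering k ≡ leaving 0 → 3 ≤ d
  shared-end-vertex⇒3≤d k eq eδ≡ℓ0 with m≤n⇒m<n∨m≡n 2≤d
  ... | inj₁ 2<d = 2<d
  ... | inj₂ d≡2 = ⊥-elim (bit-clash (subst (λ t → lookup (F 1) t ≡ true) eδ≡ℓ0' (proj₁ (entering-ok 0 1≤δ))) (proj₂ (leaving-ok 0 1≤δ)))
    where
    1≤δ : 1 ≤ δ
    1≤δ = subst (1 ≤_) eq (s≤s z≤n)
    ℓ0∈ : lookup (F 0) (leaving 0) ≡ true
    ℓ0∈ = proj₁ (leaving-ok 0 1≤δ)
    eδ∈ : lookup (F δ) (leaving 0) ≡ true
    eδ∈ = subst₂ (λ j t → lookup (F j) t ≡ true) eq eδ≡ℓ0 (proj₁ (entering-ok k (≤-reflexive eq)))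
    in-singleton : ∀ v → lookup ⁅ leaving 0 ⁆ v ≡ true → v ≡ leaving 0
    in-singleton v h = x∈⁅y⁆⇒x≡y (leaving 0) (lookup⇒[]= v ⁅ leaving 0 ⁆ h)
    δ≤1 : δ ≤ 1
    δ≤1 = geodesic 0 δ z≤n ≤-refl ⁅ leaving 0 ⁆ (trans (cong suc (∣⁅x⁆∣≡1 (leaving 0))) d≡2)
            (λ v h → subst (λ t → lookup (F 0) t ≡ true) (sym (in-singleton v h)) ℓ0∈)
            (λ v h → subst (λ t → lookup (F δ) t ≡ true) (sym (in-singleton v h)) eδ∈)
    eδ≡ℓ0' : entering 0 ≡ leaving 0
    eδ≡ℓ0' = subst (λ j → entering j ≡ leaving 0) (n≤0⇒n≡0 (≤-pred (subst (_≤ 1) (sym eq) δ≤1))) eδ≡ℓ0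

  entering-last∈ : ∀ k → suc k ≡ δ → lookup (F δ) (entering k) ≡ true
  entering-last∈ k eq = subst (λ j → lookup (F j) (entering k) ≡ true) eq (proj₁ (entering-ok k (≤-reflexive eq)))

  ends-with-apexes : ∀ k → suc k ≡ δ → (wR ℓδ : Fin n) → lookup (F δ) wR ≡ true → ¬ leaving 0 ≡ wR →
                     lookup (F δ) ℓδ ≡ true → ¬ ℓδ ≡ entering k → ¬ ℓδ ≡ wR → Ends
  ends-with-apexes k eq wR ℓδ wR∈ ℓ0≢wR ℓδ∈ ℓδ≢eδ ℓδ≢wR = record
    { e0 = proj₁ pe ; ℓδ = ℓδ ; wL = leaving 0 ; wR = wR ; e0∈ = proj₁ (proj₂ pe) ; ℓδ∈ = ℓδ∈
    ; e0ℓ = λ _ → proj₂ (proj₂ pe) ; ℓδe = λ k' e' r → ℓδ≢eδ (trans r (cong entering (suc-injective (trans e' (sym eq)))))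
    ; δ0 = λ e0 → ⊥-elim (0≢1+n (trans (sym e0) (sym eq)))
    ; wL∈ = proj₁ (leaving-ok 0 (subst (1 ≤_) eq (s≤s z≤n))) ; wL≢e = λ r → proj₂ (proj₂ pe) (sym r)
    ; wR∈ = wR∈ ; wR≢ℓ = λ r → ℓδ≢wR (sym r) ; wL≢wR = ℓ0≢wR }
    where
    pe = pick-other (F 0) (leaving 0) (2≤∣F∣ 0 z≤n)

  ends-nontrivial : ∀ k → suc k ≡ δ → Ends
  ends-nontrivial k eq with entering k ≟F leaving 0 | pick-other (F δ) (entering k) (2≤∣F∣ δ ≤-refl)
  ... | no eδ≢ℓ0 | ℓδ , ℓδ∈ , ℓδ≢eδ =
    ends-with-apexes k eq (entering k) ℓδ (entering-last∈ k eq) (λ r → eδ≢ℓ0 (sym r)) ℓδ∈ ℓδ≢eδ ℓδ≢eδ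
  ... | yes eδ≡ℓ0 | w , w∈ , w≢eδ with pick-other₂ (F δ) (entering k) w 3≤∣Fδ∣
    where
    3≤∣Fδ∣ : 3 ≤ ∣ F δ ∣
    3≤∣Fδ∣ = ≤-trans (shared-end-vertex⇒3≤d k eq eδ≡ℓ0) (≤-reflexive (sym (∣F∣≡d δ ≤-refl)))
  ...   | ℓδ , ℓδ∈ , ℓδ≢eδ , ℓδ≢w =
    ends-with-apexes k eq w ℓδ w∈ (λ r → w≢eδ (trans (sym r) (sym eδ≡ℓ0))) ℓδ∈ ℓδ≢eδ ℓδ≢w

  ends : Ends
  ends = by δ refl
    where
    by : ∀ m → m ≡ δ → Ends
    by zero e = ends-trivial (sym e)
    by (suc k) e = ends-nontrivial k e

  module E = Ends ends

  sel : ∀ {P : Set} → Dec P → Fin n → Fin n → Fin n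
  sel (yes _) a b = a
  sel (no _) a b = b

  sel-yes : ∀ {P : Set} (q : Dec P) a b → P → sel q a b ≡ a
  sel-yes (yes _) a b _ = refl
  sel-yes (no nq) a b p = ⊥-elim (nq p)
  sel-no : ∀ {P : Set} (q : Dec P) a b → ¬ P → sel q a b ≡ b
  sel-no (yes p) a b np = ⊥-elim (np p)
  sel-no (no _) a b _ = refl

  ℓ′ : ℕ → Fin n
  ℓ′ i = sel (suc i ≤? δ) (leaving i) E.ℓδ

  e′ : ℕ → Fin n
  e′ zero = E.e0
  e′ (suc k) = entering k

  ℓ-lt : ∀ i → suc i ≤ δ → ℓ′ i ≡ leaving i
  ℓ-lt i lt = sel-yes (suc i ≤? δ) (leaving i) E.ℓδ lt
  ℓ-ge : ∀ i → ¬ suc i ≤ δ → ℓ′ i ≡ E.ℓδ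
  ℓ-ge i nl = sel-no (suc i ≤? δ) (leaving i) E.ℓδ nl

  ℓ-δ : ℓ′ δ ≡ E.ℓδ
  ℓ-δ = ℓ-ge δ (λ lt → <-irrefl refl lt)

  ge⇒eq : ∀ i → i ≤ δ → ¬ suc i ≤ δ → i ≡ δ
  ge⇒eq i le nl = ≤-antisym le (≮⇒≥ nl)

  geodesicPath : GeodesicPath n d
  geodesicPath = record
    { δ = δ ; F = F ; e = e′ ; ℓ = ℓ′ ; wL = E.wL ; wR = E.wR
    ; ∣F∣≡d = ∣F∣≡d ; e∈ = e∈' ; ℓ∈ = ℓ∈' ; e≢ℓ = e≢ℓ'
    ; F-step = λ i lt v n1 n2 → F-step i lt v (λ r → n1 (trans r (sym (ℓ-lt i lt)))) n2
    ; ℓ∉ = λ i lt → subst (λ t → lookup (F (suc i)) t ≡ false) (sym (ℓ-lt i lt)) (proj₂ (leaving-ok i lt))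
    ; e∉ = λ i lt → proj₂ (entering-ok i lt)
    ; geodesic = geodesic ; F-injective = F-injective
    ; wL∈ = E.wL∈ ; wL≢e = E.wL≢e ; wR∈ = E.wR∈ ; wR≢ℓ = λ r → E.wR≢ℓ (trans r ℓ-δ) ; wL≢wR = E.wL≢wR }
    where
    e∈' : ∀ i → i ≤ δ → lookup (F i) (e′ i) ≡ true
    e∈' zero _ = E.e0∈
    e∈' (suc k) le = proj₁ (entering-ok k le)
    ℓ∈' : ∀ i → i ≤ δ → lookup (F i) (ℓ′ i) ≡ true
    ℓ∈' i le = h (suc i ≤? δ)
      where
      h : Dec (suc i ≤ δ) → lookup (F i) (ℓ′ i) ≡ true
      h (yes lt) = subst (λ t → lookup (F i) t ≡ true) (sym (ℓ-lt i lt)) (proj₁ (leaving-ok i lt))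
      h (no nl) = subst (λ t → lookup (F i) t ≡ true) (sym (ℓ-ge i nl)) (subst (λ j → lookup (F j) E.ℓδ ≡ true) (sym (ge⇒eq i le nl)) E.ℓδ∈)
    e≢ℓ' : ∀ i → i ≤ δ → ¬ e′ i ≡ ℓ′ i
    e≢ℓ' zero le = h (1 ≤? δ)
      where
      h : Dec (1 ≤ δ) → ¬ e′ 0 ≡ ℓ′ 0
      h (yes lt) = λ r → E.e0ℓ lt (trans r (ℓ-lt 0 lt))
      h (no nl) = λ r → E.δ0 (sym (ge⇒eq 0 le nl)) (trans r (ℓ-ge 0 nl))
    e≢ℓ' (suc k) le = h (suc (suc k) ≤? δ)
      where
      h : Dec (suc (suc k) ≤ δ) → ¬ e′ (suc k) ≡ ℓ′ (suc k)
      h (yes lt) = λ r → entering≢leaving k lt (trans r (ℓ-lt (suc k) lt))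
      h (no nl) = λ r → E.ℓδe k (ge⇒eq (suc k) le nl) (sym (trans r (ℓ-ge (suc k) nl)))

theorem1p6 : ∀ (n d δ : ℕ) (C : Complex n) → 2 ≤ d →
    IsPure d C → StronglyConnected d C → HasDiameter d C δ →
    Σ (Complex (2 * n)) λ P → IsPseudoManifold d P × DiameterAtLeast d P (δ + 2)
theorem1p6 n d δ C 2≤d pure _ (_ , F0 , G0 , _ , _ , w , minimal) =
  Construction.P π , PseudoManifold.P-pseudoManifold π , PseudoManifold.P-diameter π
  where
  π = GeodesicFromWalk.geodesicPath C pure 2≤d F0 G0 δ w minimal
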